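{- Let $\mathbf{x}$ be a set of indeterminates and, for $n\ge1$, let $a_n,b_n,c_n,a'_n,b'_n,c'_n$ be polynomials in $\mathbf{x}$ such that each of $a_n,b_n,c_n,a'_n,b'_n,c'_n,b_n-b'_n,c_n-c'_n$ has nonnegative coefficients. If the infinite tridiagonal matrix with diagonal $(a_1,a_2,\dots)$, superdiagonal $(b_1,b_2,\dots)$ and subdiagonal $(c_1,c_2,\dots)$ is $\mathbf{x}$-TP$_r$, then so is the tridiagonal matrix with diagonal $(a_1+a'_1,a_2+a'_2,\dots)$, superdiagonal $(b_1-b'_1,b_2-b'_2,\dots)$ and subdiagonal $(c_1-c'_1,c_2-c'_2,\dots)$.
   Context: A matrix with entries in $\mathbb{R}[\mathbf{x}]$ is $\mathbf{x}$-TP$_r$ if all its minors of order $\le r$ are polynomials in $\mathbf{x}$ with nonnegative coefficients. -}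

module Defs where

open import Level using (Level; _⊔_)
open import Algebra.Bundles using (CommutativeRing)
open import Relation.Binary.Structures using (IsTotalOrder)
open import Data.Nat as ℕ using (ℕ; zero; suc)
open import Data.Fin as Fin using (Fin; zero; suc; toℕ; punchIn)
open import Data.Product using (_×_; _,_)
open import Data.List as List using (List; []; _∷_; _++_; concatMap)
open import Data.List.Properties using (≡-dec)
open import Data.Bool using (Bool; true; false; if_then_else_)
open import Relation.Nullary.Decidable using (does)
open import Relation.Binary.PropositionalEquality using (_≡_)

-- An ordered commutative ring: a commutative ring with a total order
-- compatible with addition and with 0 ≤ x, 0 ≤ y ⇒ 0 ≤ x * y.
-- (ℝ is an instance; the paper works over ℝ.)
record OrderedCommRing (c ℓ₁ ℓ₂ : Level) : Set (Level.suc (c ⊔ ℓ₁ ⊔ ℓ₂)) where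
  field
    commRing : CommutativeRing c ℓ₁
  open CommutativeRing commRing public
  field
    _≤_        : Carrier → Carrier → Set ℓ₂
    isTotalOrder : IsTotalOrder _≈_ _≤_
    +-mono-≤   : ∀ {x y} z → x ≤ y → (x + z) ≤ (y + z)
    *-nonneg   : ∀ {x y} → 0# ≤ x → 0# ≤ y → 0# ≤ (x * y)

module Poly {c ℓ₁ ℓ₂} (O : OrderedCommRing c ℓ₁ ℓ₂) where
  open OrderedCommRing O using (Carrier; _≤_; _+_; _*_; -_; 0#; 1#)

  -- A monomial is an exponent list [e₀, e₁, …] meaning x₀^e₀ x₁^e₁ ⋯
  -- (trailing zeros are irrelevant).
  Monomial : Set
  Monomial = List ℕ

  normMono : Monomial → Monomial
  normMono [] = []
  normMono (e ∷ es) with normMono es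
  ... | [] with e
  ...      | zero = []
  ...      | suc k = suc k ∷ []
  normMono (e ∷ es) | n ∷ ns = e ∷ n ∷ ns

  monoMul : Monomial → Monomial → Monomial
  monoMul [] ν = ν
  monoMul (e ∷ μ) [] = e ∷ μ
  monoMul (e ∷ μ) (f ∷ ν) = (e ℕ.+ f) ∷ monoMul μ ν

  sameMono : Monomial → Monomial → Bool
  sameMono μ ν = does (≡-dec ℕ._≟_ (normMono μ) (normMono ν))

  Polynomial : Set c
  Polynomial = List (Carrier × Monomial)

  coeff : Polynomial → Monomial → Carrier
  coeff [] μ = 0#
  coeff ((a , ν) ∷ p) μ = (if sameMono ν μ then a else 0#) + coeff p μ

  NonnegCoeffs : Polynomial → Set ℓ₂
  NonnegCoeffs p = ∀ (μ : Monomial) → 0# ≤ coeff p μ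

  0ₚ : Polynomial
  0ₚ = []

  1ₚ : Polynomial
  1ₚ = (1# , []) ∷ []

  _+ₚ_ : Polynomial → Polynomial → Polynomial
  p +ₚ q = p ++ q

  -ₚ_ : Polynomial → Polynomial
  -ₚ p = List.map (λ { (a , μ) → (- a , μ) }) p

  _-ₚ_ : Polynomial → Polynomial → Polynomial
  p -ₚ q = p +ₚ (-ₚ q)

  _*ₚ_ : Polynomial → Polynomial → Polynomial
  p *ₚ q = concatMap (λ { (a , μ) → List.map (λ { (b , ν) → (a * b , monoMul μ ν) }) q }) p

  signed : ℕ → Polynomial → Polynomial
  signed zero p = p
  signed (suc zero) p = -ₚ p
  signed (suc (suc j)) p = signed j p

  sumFin : ∀ {n} → (Fin n → Polynomial) → Polynomial
  sumFin {zero} f = 0ₚ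
  sumFin {suc n} f = f zero +ₚ sumFin (λ i → f (suc i))

  det : ∀ {k} → (Fin k → Fin k → Polynomial) → Polynomial
  det {zero} M = 1ₚ
  det {suc k} M =
    sumFin (λ j → signed (toℕ j) (M zero j *ₚ det (λ r s → M (suc r) (punchIn j s))))

  -- infinite matrices indexed by ℕ × ℕ (row/column 0 is the paper's 1)
  InfMatrix : Set c
  InfMatrix = ℕ → ℕ → Polynomial

  -- tridiagonal matrix with diagonal d, superdiagonal u, subdiagonal l:
  -- entry (i,i) = d i, (i,i+1) = u i, (i+1,i) = l i, others 0.
  tridiag : (d u l : ℕ → Polynomial) → InfMatrix
  tridiag d u l i j with ℕ.compare i j
  ... | ℕ.equal .i = d i
  ... | ℕ.less .i zero = u i
  ... | ℕ.less .i (suc _) = 0ₚ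
  ... | ℕ.greater .j zero = l j
  ... | ℕ.greater .j (suc _) = 0ₚ

  StrictlyIncreasing : ∀ {k} → (Fin k → ℕ) → Set
  StrictlyIncreasing {k} f = ∀ (i j : Fin k) → i Fin.< j → f i ℕ.< f j

  minor : InfMatrix → ∀ {k} → (Fin k → ℕ) → (Fin k → ℕ) → Polynomial
  minor A I J = det (λ r s → A (I r) (J s))

  TP : ℕ → InfMatrix → Set ℓ₂
  TP r A = ∀ (k : ℕ) → k ℕ.≤ r → (I J : Fin k → ℕ) →
           StrictlyIncreasing I → StrictlyIncreasing J →
           NonnegCoeffs (minor A I J)

-- Expanding along the first row, every minor of a tridiagonal matrix is a product of
-- off-diagonal entries and continuants (contiguous principal minors), or zero.  Hence a
-- tridiagonal matrix whose off-diagonal entries have nonnegative coefficients is x-TP_r as soon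
-- as its continuants of order ≤ r are.  For the new matrix the off-diagonal entries b - b',
-- c - c' are nonnegative by hypothesis.  Its continuants D' (diagonal a + a', off-diagonal
-- products β' = (b - b')(c - c')) differ from the old ones D (diagonal a, products β = bc) by a
-- solution of the continuant recurrence of D with a source term built from a', smaller D' and
-- β - β' = bc' + b'(c - c'); by variation of constants D' = D + Σₖ D(k)·source(n - k), and
-- induction on the order shows D' has nonnegative coefficients.

module Submission where

open import Defs
open import Algebra.Bundles using (CommutativeRing)
open import Algebra.Structures using (IsCommutativeRing)
open import Data.Bool using (true; false; if_then_else_)
open import Data.Nat as ℕ using (ℕ; zero; suc; z≤n; s≤s; _∸_)
import Data.Nat.Properties as ℕₚ
open import Data.Fin as Fin using (Fin; zero; suc; toℕ; punchIn; punchOut)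
import Data.Fin.Properties as Finₚ
open import Data.List as List using (List; []; _∷_; _++_; length)
open import Data.List.Properties using (≡-dec; ++-identityʳ; ++-assoc)
open import Data.Product using (_×_; _,_; proj₁; proj₂)
open import Data.Sum using (inj₁; inj₂)
open import Function using (_∘_)
open import Induction.WellFounded using (Acc; acc)
open import Data.Nat.Induction using (<-wellFounded; <-rec)
open import Relation.Nullary using (¬_; Dec; yes; no)
open import Relation.Nullary.Decidable using (does; proof; map′; _×-dec_)
open import Relation.Nullary.Reflects using (Reflects; ofʸ; ofⁿ)
open import Relation.Binary.PropositionalEquality as ≡ using (_≡_; _≢_; cong; cong₂)
open import Relation.Binary.Structures using (IsTotalOrder)
open import Relation.Binary.Definitions using (tri<; tri≈; tri>)
open import Data.Empty using (⊥-elim)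
open import Data.Maybe using (Maybe; just; nothing)
open import Data.Integer as ℤ using (ℤ; +_; -[1+_]; _⊖_)
import Data.Integer.Properties as ℤₚ
import Data.Sign as Sign
open import Algebra.Solver.Ring.AlmostCommutativeRing
  using (_-Raw-AlmostCommutative⟶_; fromCommutativeRing)

module MonomialProperties {c ℓ₁ ℓ₂} (O : OrderedCommRing c ℓ₁ ℓ₂) where
  open Poly O using (Monomial; normMono; monoMul; sameMono)

  exponent : Monomial → ℕ → ℕ
  exponent []       i       = 0
  exponent (e ∷ es) zero    = e
  exponent (e ∷ es) (suc i) = exponent es i

  trimCons : ℕ → Monomial → Monomial
  trimCons e       (n ∷ ns) = e ∷ n ∷ ns
  trimCons zero    []       = []
  trimCons (suc k) []       = suc k ∷ []

  normMono-∷ : ∀ e es → normMono (e ∷ es) ≡ trimCons e (normMono es)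
  normMono-∷ e es with normMono es
  ... | [] with e
  ...   | zero  = ≡.refl
  ...   | suc k = ≡.refl
  normMono-∷ e es | n ∷ ns = ≡.refl

  exponent-trimCons : ∀ e ν i → exponent (trimCons e ν) i ≡ exponent (e ∷ ν) i
  exponent-trimCons e       (n ∷ ns) i       = ≡.refl
  exponent-trimCons zero    []       zero    = ≡.refl
  exponent-trimCons zero    []       (suc i) = ≡.refl
  exponent-trimCons (suc k) []       zero    = ≡.refl
  exponent-trimCons (suc k) []       (suc i) = ≡.refl

  exponent-normMono : ∀ ν i → exponent (normMono ν) i ≡ exponent ν i
  exponent-normMono []       i = ≡.refl
  exponent-normMono (e ∷ es) i rewrite normMono-∷ e es =
    ≡.trans (exponent-trimCons e (normMono es) i) (tail i)
    where
    tail : ∀ i → exponent (e ∷ normMono es) i ≡ exponent (e ∷ es) i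
    tail zero    = ≡.refl
    tail (suc i) = exponent-normMono es i

  normMono-ext : ∀ ν ν' → (∀ i → exponent ν i ≡ exponent ν' i) → normMono ν ≡ normMono ν'
  normMono-ext []      []       h = ≡.refl
  normMono-ext []      (f ∷ ν') h
    rewrite normMono-∷ f ν' | ≡.sym (normMono-ext [] ν' (h ∘ suc)) | ≡.sym (h zero) = ≡.refl
  normMono-ext (e ∷ ν) []       h
    rewrite normMono-∷ e ν | normMono-ext ν [] (h ∘ suc) | h zero = ≡.refl
  normMono-ext (e ∷ ν) (f ∷ ν') h
    rewrite normMono-∷ e ν | normMono-∷ f ν' | normMono-ext ν ν' (h ∘ suc) | h zero = ≡.refl

  exponent-monoMul : ∀ μ ν i → exponent (monoMul μ ν) i ≡ exponent μ i ℕ.+ exponent ν i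
  exponent-monoMul []      ν       i       = ≡.refl
  exponent-monoMul (e ∷ μ) []      i       = ≡.sym (ℕₚ.+-identityʳ _)
  exponent-monoMul (e ∷ μ) (f ∷ ν) zero    = ≡.refl
  exponent-monoMul (e ∷ μ) (f ∷ ν) (suc i) = exponent-monoMul μ ν i

  monoMul-comm : ∀ μ ν → monoMul μ ν ≡ monoMul ν μ
  monoMul-comm []      []      = ≡.refl
  monoMul-comm []      (f ∷ ν) = ≡.refl
  monoMul-comm (e ∷ μ) []      = ≡.refl
  monoMul-comm (e ∷ μ) (f ∷ ν) = cong₂ _∷_ (ℕₚ.+-comm e f) (monoMul-comm μ ν)

  monoMul-assoc : ∀ μ ν ρ → monoMul (monoMul μ ν) ρ ≡ monoMul μ (monoMul ν ρ)
  monoMul-assoc []      ν       ρ       = ≡.refl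
  monoMul-assoc (e ∷ μ) []      ρ       = ≡.refl
  monoMul-assoc (e ∷ μ) (f ∷ ν) []      = ≡.refl
  monoMul-assoc (e ∷ μ) (f ∷ ν) (g ∷ ρ) = cong₂ _∷_ (ℕₚ.+-assoc e f g) (monoMul-assoc μ ν ρ)

  infix 4 _≃ₘ_
  record _≃ₘ_ (ν μ : Monomial) : Set where
    constructor mk≃ₘ
    field normMono-≡ : normMono ν ≡ normMono μ
  open _≃ₘ_ public

  _≃ₘ?_ : ∀ ν μ → Dec (ν ≃ₘ μ)
  ν ≃ₘ? μ = map′ mk≃ₘ normMono-≡ (≡-dec ℕ._≟_ (normMono ν) (normMono μ))

  sameMono-reflects : ∀ ν μ → Reflects (ν ≃ₘ μ) (sameMono ν μ)
  sameMono-reflects ν μ = proof (ν ≃ₘ? μ)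

  sameMono-refl : ∀ ν → sameMono ν ν ≡ true
  sameMono-refl ν with sameMono ν ν | sameMono-reflects ν ν
  ... | true  | _      = ≡.refl
  ... | false | ofⁿ ¬e = ⊥-elim (¬e (mk≃ₘ ≡.refl))

  sameMono-congˡ : ∀ {ν ν'} μ → ν ≃ₘ ν' → sameMono ν μ ≡ sameMono ν' μ
  sameMono-congˡ μ e = cong (λ x → does (≡-dec ℕ._≟_ x (normMono μ))) (normMono-≡ e)

  monoMul-congˡ : ∀ {ν ν'} ρ → ν ≃ₘ ν' → monoMul ν ρ ≃ₘ monoMul ν' ρ
  monoMul-congˡ {ν} {ν'} ρ e = mk≃ₘ (normMono-ext (monoMul ν ρ) (monoMul ν' ρ) λ i → begin
    exponent (monoMul ν ρ) i           ≡⟨ exponent-monoMul ν ρ i ⟩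
    exponent ν i ℕ.+ exponent ρ i      ≡⟨ cong (ℕ._+ exponent ρ i) (same i) ⟩
    exponent ν' i ℕ.+ exponent ρ i     ≡⟨ exponent-monoMul ν' ρ i ⟨
    exponent (monoMul ν' ρ) i          ∎)
    where
    open ≡.≡-Reasoning
    same : ∀ i → exponent ν i ≡ exponent ν' i
    same i = ≡.trans (≡.sym (exponent-normMono ν i))
               (≡.trans (cong (λ m → exponent m i) (normMono-≡ e)) (exponent-normMono ν' i))

  monoMul-congʳ : ∀ ρ {ν ν'} → ν ≃ₘ ν' → monoMul ρ ν ≃ₘ monoMul ρ ν'
  monoMul-congʳ ρ {ν} {ν'} e rewrite monoMul-comm ρ ν | monoMul-comm ρ ν' = monoMul-congˡ ρ e

module PolynomialRing {c ℓ₁ ℓ₂} (O : OrderedCommRing c ℓ₁ ℓ₂) where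
  open OrderedCommRing O hiding (zero)
  open IsTotalOrder isTotalOrder using ()
    renaming (reflexive to ≤-reflexive; trans to ≤-trans; total to ≤-total)
  open Poly O
  open MonomialProperties O
  open import Algebra.Properties.Ring ring using (-‿distribˡ-*; -1*x≈-x)
  open import Algebra.Properties.AbelianGroup +-abelianGroup using (⁻¹-∙-comm)
  open import Algebra.Properties.Group +-group using (ε⁻¹≈ε; ⁻¹-involutive; x∙y⁻¹≈ε⇒x≈y)
  open import Algebra.Properties.CommutativeSemigroup +-commutativeSemigroup using (interchange)
  open import Relation.Binary.Reasoning.Setoid setoid

  0≤-respˡ-≈ : ∀ {x y} → x ≈ y → 0# ≤ y → 0# ≤ x
  0≤-respˡ-≈ x≈y 0≤y = ≤-trans 0≤y (≤-reflexive (sym x≈y))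

  0≤0 : 0# ≤ 0#
  0≤0 = ≤-reflexive refl

  0≤+ : ∀ {x y} → 0# ≤ x → 0# ≤ y → 0# ≤ (x + y)
  0≤+ {x} {y} 0≤x 0≤y = ≤-trans (0≤-respˡ-≈ (+-identityˡ y) 0≤y) (+-mono-≤ y 0≤x)

  0≤1 : 0# ≤ 1#
  0≤1 with ≤-total 0# 1#
  ... | inj₁ 0≤1 = 0≤1
  ... | inj₂ 1≤0 = 0≤-respˡ-≈ (sym (trans (-1*x≈-x (- 1#)) (⁻¹-involutive 1#))) (*-nonneg 0≤-1 0≤-1)
    where
    0≤-1 : 0# ≤ (- 1#)
    0≤-1 = ≤-trans (≤-reflexive (sym (-‿inverseʳ 1#)))
             (≤-trans (+-mono-≤ (- 1#) 1≤0) (≤-reflexive (+-identityˡ _)))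

  infix 4 _≋_
  record _≋_ (p q : Polynomial) : Set ℓ₁ where
    constructor mk≋
    field coeff-≈ : ∀ μ → coeff p μ ≈ coeff q μ
  open _≋_ public

  ≋-refl : ∀ {p} → p ≋ p
  ≋-refl = mk≋ λ _ → refl

  ≋-sym : ∀ {p q} → p ≋ q → q ≋ p
  ≋-sym p≋q = mk≋ λ μ → sym (coeff-≈ p≋q μ)

  ≋-trans : ∀ {p q r} → p ≋ q → q ≋ r → p ≋ r
  ≋-trans p≋q q≋r = mk≋ λ μ → trans (coeff-≈ p≋q μ) (coeff-≈ q≋r μ)

  ≡⇒≋ : ∀ {p q} → p ≡ q → p ≋ q
  ≡⇒≋ ≡.refl = ≋-refl

  coeff-++ : ∀ p q μ → coeff (p ++ q) μ ≈ coeff p μ + coeff q μ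
  coeff-++ []            q μ = sym (+-identityˡ _)
  coeff-++ ((a , ν) ∷ p) q μ = trans (+-congˡ (coeff-++ p q μ)) (sym (+-assoc _ _ _))

  coeff-neg : ∀ p μ → coeff (-ₚ p) μ ≈ - coeff p μ
  coeff-neg []            μ = sym ε⁻¹≈ε
  coeff-neg ((a , ν) ∷ p) μ = trans (+-cong (if-neg (sameMono ν μ)) (coeff-neg p μ)) (⁻¹-∙-comm _ _)
    where
    if-neg : ∀ b → (if b then - a else 0#) ≈ - (if b then a else 0#)
    if-neg true  = refl
    if-neg false = sym ε⁻¹≈ε

  -- Polynomials are unnormalised term lists.  Since coeff p μ = weightedSum p (indicator μ),
  -- the ring laws for coefficientwise equality reduce to identities between weighted sums.
  weightedSum : Polynomial → (Monomial → Carrier) → Carrier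
  weightedSum []            w = 0#
  weightedSum ((a , ν) ∷ p) w = a * w ν + weightedSum p w

  indicator : Monomial → Monomial → Carrier
  indicator μ ν = if sameMono ν μ then 1# else 0#

  RespectsMonomial : (Monomial → Carrier) → Set ℓ₁
  RespectsMonomial w = ∀ {ν ν'} → ν ≃ₘ ν' → w ν ≈ w ν'

  indicator-resp : ∀ μ → RespectsMonomial (indicator μ)
  indicator-resp μ e = reflexive (cong (λ b → if b then 1# else 0#) (sameMono-congˡ μ e))

  indicator-nonneg : ∀ μ ν → 0# ≤ indicator μ ν
  indicator-nonneg μ ν with sameMono ν μ
  ... | true  = 0≤1
  ... | false = 0≤0

  coeff≈weightedSum-indicator : ∀ p μ → coeff p μ ≈ weightedSum p (indicator μ)
  coeff≈weightedSum-indicator []            μ = refl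
  coeff≈weightedSum-indicator ((a , ν) ∷ p) μ =
    +-cong (if-scale (sameMono ν μ)) (coeff≈weightedSum-indicator p μ)
    where
    if-scale : ∀ b → (if b then a else 0#) ≈ a * (if b then 1# else 0#)
    if-scale true  = sym (*-identityʳ a)
    if-scale false = sym (zeroʳ a)

  weightedSum-++ : ∀ p q w → weightedSum (p ++ q) w ≈ weightedSum p w + weightedSum q w
  weightedSum-++ []            q w = sym (+-identityˡ _)
  weightedSum-++ ((a , ν) ∷ p) q w = trans (+-congˡ (weightedSum-++ p q w)) (sym (+-assoc _ _ _))

  weightedSum-neg : ∀ p w → weightedSum (-ₚ p) w ≈ - weightedSum p w
  weightedSum-neg []            w = sym ε⁻¹≈ε
  weightedSum-neg ((a , ν) ∷ p) w =
    trans (+-cong (sym (-‿distribˡ-* a (w ν))) (weightedSum-neg p w)) (⁻¹-∙-comm _ _)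

  weightedSum-congʳ : ∀ p {w w'} → (∀ ν → w ν ≈ w' ν) → weightedSum p w ≈ weightedSum p w'
  weightedSum-congʳ []            w≈w' = refl
  weightedSum-congʳ ((a , ν) ∷ p) w≈w' = +-cong (*-congˡ (w≈w' ν)) (weightedSum-congʳ p w≈w')

  weightedSum-+ : ∀ p w w' → weightedSum p (λ ν → w ν + w' ν) ≈ weightedSum p w + weightedSum p w'
  weightedSum-+ []            w w' = sym (+-identityˡ _)
  weightedSum-+ ((a , ν) ∷ p) w w' =
    trans (+-cong (distribˡ a (w ν) (w' ν)) (weightedSum-+ p w w')) (interchange _ _ _ _)

  weightedSum-scale : ∀ p x w → weightedSum p (λ ν → x * w ν) ≈ x * weightedSum p w
  weightedSum-scale []            x w = sym (zeroʳ x)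
  weightedSum-scale ((a , ν) ∷ p) x w =
    trans (+-cong (x∙yz≈y∙xz a x (w ν)) (weightedSum-scale p x w)) (sym (distribˡ x _ _))
    where
    x∙yz≈y∙xz : ∀ x y z → x * (y * z) ≈ y * (x * z)
    x∙yz≈y∙xz x y z = trans (sym (*-assoc x y z)) (trans (*-congʳ (*-comm x y)) (*-assoc y x z))

  weightedSum-zero : ∀ p → weightedSum p (λ _ → 0#) ≈ 0#
  weightedSum-zero []            = refl
  weightedSum-zero ((a , ν) ∷ p) = trans (+-cong (zeroʳ a) (weightedSum-zero p)) (+-identityˡ 0#)

  weightedSum-swap : ∀ p q (w : Monomial → Monomial → Carrier) →
    weightedSum p (λ ν → weightedSum q (w ν)) ≈ weightedSum q (λ ν' → weightedSum p (λ ν → w ν ν'))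
  weightedSum-swap []            q w = sym (weightedSum-zero q)
  weightedSum-swap ((a , ν) ∷ p) q w = begin
    a * weightedSum q (w ν) + weightedSum p (λ ν₁ → weightedSum q (w ν₁))
      ≈⟨ +-cong (sym (weightedSum-scale q a (w ν))) (weightedSum-swap p q w) ⟩
    weightedSum q (λ ν' → a * w ν ν') + weightedSum q (λ ν' → weightedSum p (λ ν₁ → w ν₁ ν'))
      ≈⟨ weightedSum-+ q _ _ ⟨
    weightedSum q (λ ν' → a * w ν ν' + weightedSum p (λ ν₁ → w ν₁ ν')) ∎

  *ₚ-∷ : ∀ t p q → (t ∷ p) *ₚ q ≡ ((t ∷ []) *ₚ q) ++ (p *ₚ q)
  *ₚ-∷ t p q = cong (_++ (p *ₚ q)) (≡.sym (++-identityʳ _))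

  weightedSum-*ₚ : ∀ p q w →
    weightedSum (p *ₚ q) w ≈ weightedSum p (λ ν → weightedSum q (λ ν' → w (monoMul ν ν')))
  weightedSum-*ₚ []            q w = refl
  weightedSum-*ₚ ((a , ν) ∷ p) q w rewrite *ₚ-∷ (a , ν) p q =
    trans (weightedSum-++ (((a , ν) ∷ []) *ₚ q) (p *ₚ q) w)
      (+-cong (term q) (weightedSum-*ₚ p q w))
    where
    term : ∀ q → weightedSum (((a , ν) ∷ []) *ₚ q) w ≈ a * weightedSum q (λ ν' → w (monoMul ν ν'))
    term []             = sym (zeroʳ a)
    term ((b , ν') ∷ q) = trans (+-cong (*-assoc a b _) (term q)) (sym (distribˡ a _ _))

  coeff-*ₚ : ∀ p q μ →
    coeff (p *ₚ q) μ ≈ weightedSum p (λ ν → weightedSum q (λ ν' → indicator μ (monoMul ν ν')))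
  coeff-*ₚ p q μ = trans (coeff≈weightedSum-indicator (p *ₚ q) μ) (weightedSum-*ₚ p q (indicator μ))

  dropMonomial : Monomial → Polynomial → Polynomial
  dropMonomial ν₀ []            = []
  dropMonomial ν₀ ((b , ν) ∷ p) =
    if sameMono ν ν₀ then dropMonomial ν₀ p else (b , ν) ∷ dropMonomial ν₀ p

  weightedSum-dropMonomial : ∀ ν₀ p w → RespectsMonomial w →
    weightedSum p w ≈ coeff p ν₀ * w ν₀ + weightedSum (dropMonomial ν₀ p) w
  weightedSum-dropMonomial ν₀ []            w w-resp =
    sym (trans (+-congʳ (zeroˡ _)) (+-identityˡ 0#))
  weightedSum-dropMonomial ν₀ ((b , ν) ∷ p) w w-resp
    with sameMono ν ν₀ | sameMono-reflects ν ν₀ | weightedSum-dropMonomial ν₀ p w w-resp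
  ... | true  | ofʸ ν≃ν₀ | ih = begin
    b * w ν + weightedSum p w
      ≈⟨ +-cong (*-congˡ (w-resp ν≃ν₀)) ih ⟩
    b * w ν₀ + (coeff p ν₀ * w ν₀ + weightedSum (dropMonomial ν₀ p) w)
      ≈⟨ +-assoc _ _ _ ⟨
    (b * w ν₀ + coeff p ν₀ * w ν₀) + weightedSum (dropMonomial ν₀ p) w
      ≈⟨ +-congʳ (distribʳ _ _ _) ⟨
    (b + coeff p ν₀) * w ν₀ + weightedSum (dropMonomial ν₀ p) w ∎
  ... | false | ofⁿ _    | ih = begin
    b * w ν + weightedSum p w
      ≈⟨ +-congˡ ih ⟩
    b * w ν + (coeff p ν₀ * w ν₀ + weightedSum (dropMonomial ν₀ p) w)
      ≈⟨ x+[y+z]≈y+[x+z] _ _ _ ⟩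
    coeff p ν₀ * w ν₀ + (b * w ν + weightedSum (dropMonomial ν₀ p) w)
      ≈⟨ +-congʳ (*-congʳ (+-identityˡ _)) ⟨
    (0# + coeff p ν₀) * w ν₀ + (b * w ν + weightedSum (dropMonomial ν₀ p) w) ∎
    where
    x+[y+z]≈y+[x+z] : ∀ x y z → x + (y + z) ≈ y + (x + z)
    x+[y+z]≈y+[x+z] x y z =
      trans (sym (+-assoc x y z)) (trans (+-congʳ (+-comm x y)) (+-assoc y x z))

  coeff-dropMonomial-≃ : ∀ ν₀ p {μ} → μ ≃ₘ ν₀ → coeff (dropMonomial ν₀ p) μ ≈ 0#
  coeff-dropMonomial-≃ ν₀ [] μ≃ν₀ = refl
  coeff-dropMonomial-≃ ν₀ ((b , ν) ∷ p) {μ} μ≃ν₀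
    with sameMono ν ν₀ | sameMono-reflects ν ν₀
  ... | true  | _       = coeff-dropMonomial-≃ ν₀ p μ≃ν₀
  ... | false | ofⁿ ν≄ν₀ with sameMono ν μ | sameMono-reflects ν μ
  ...   | true  | ofʸ ν≃μ = ⊥-elim (ν≄ν₀ (mk≃ₘ (≡.trans (normMono-≡ ν≃μ) (normMono-≡ μ≃ν₀))))
  ...   | false | _       = trans (+-identityˡ _) (coeff-dropMonomial-≃ ν₀ p μ≃ν₀)

  coeff-dropMonomial-≄ : ∀ ν₀ p {μ} → ¬ μ ≃ₘ ν₀ → coeff (dropMonomial ν₀ p) μ ≈ coeff p μ
  coeff-dropMonomial-≄ ν₀ [] μ≄ν₀ = refl
  coeff-dropMonomial-≄ ν₀ ((b , ν) ∷ p) {μ} μ≄ν₀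
    with sameMono ν ν₀ | sameMono-reflects ν ν₀
  ... | false | _       = +-congˡ (coeff-dropMonomial-≄ ν₀ p μ≄ν₀)
  ... | true  | ofʸ ν≃ν₀ with sameMono ν μ | sameMono-reflects ν μ
  ...   | true  | ofʸ ν≃μ = ⊥-elim (μ≄ν₀ (mk≃ₘ (≡.trans (≡.sym (normMono-≡ ν≃μ)) (normMono-≡ ν≃ν₀))))
  ...   | false | _       = trans (coeff-dropMonomial-≄ ν₀ p μ≄ν₀) (sym (+-identityˡ _))

  dropMonomial-preserves : ∀ {ℓ} (P : Carrier → Set ℓ) → (∀ {x y} → x ≈ y → P y → P x) → P 0# →
    ∀ ν₀ p → (∀ μ → P (coeff p μ)) → ∀ μ → P (coeff (dropMonomial ν₀ p) μ)
  dropMonomial-preserves P resp P0 ν₀ p Pp μ with μ ≃ₘ? ν₀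
  ... | yes μ≃ν₀ = resp (coeff-dropMonomial-≃ ν₀ p μ≃ν₀) P0
  ... | no  μ≄ν₀ = resp (coeff-dropMonomial-≄ ν₀ p μ≄ν₀) (Pp μ)

  dropMonomial-shorter : ∀ a ν₀ p → length (dropMonomial ν₀ ((a , ν₀) ∷ p)) ℕ.< length ((a , ν₀) ∷ p)
  dropMonomial-shorter a ν₀ p rewrite sameMono-refl ν₀ = s≤s (length-dropMonomial p)
    where
    length-dropMonomial : ∀ p → length (dropMonomial ν₀ p) ℕ.≤ length p
    length-dropMonomial []            = z≤n
    length-dropMonomial ((b , ν) ∷ p) with sameMono ν ν₀
    ... | true  = ℕₚ.m≤n⇒m≤1+n (length-dropMonomial p)
    ... | false = s≤s (length-dropMonomial p)

  weightedSum-null : ∀ p w → RespectsMonomial w → (∀ μ → coeff p μ ≈ 0#) → weightedSum p w ≈ 0#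
  weightedSum-null p w w-resp = go p (<-wellFounded (length p))
    where
    go : ∀ p → Acc ℕ._<_ (length p) → (∀ μ → coeff p μ ≈ 0#) → weightedSum p w ≈ 0#
    go []                 _        _   = refl
    go p@((a , ν₀) ∷ p') (acc rec) p≈0 = begin
      weightedSum p w
        ≈⟨ weightedSum-dropMonomial ν₀ p w w-resp ⟩
      coeff p ν₀ * w ν₀ + weightedSum (dropMonomial ν₀ p) w
        ≈⟨ +-cong (trans (*-congʳ (p≈0 ν₀)) (zeroˡ _))
                  (go (dropMonomial ν₀ p) (rec (dropMonomial-shorter a ν₀ p'))
                      (dropMonomial-preserves (_≈ 0#) trans refl ν₀ p p≈0)) ⟩
      0# + 0#
        ≈⟨ +-identityˡ 0# ⟩
      0# ∎

  weightedSum-nonneg : ∀ p w → RespectsMonomial w → (∀ ν → 0# ≤ w ν) →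
    NonnegCoeffs p → 0# ≤ weightedSum p w
  weightedSum-nonneg p w w-resp w≥0 = go p (<-wellFounded (length p))
    where
    go : ∀ p → Acc ℕ._<_ (length p) → NonnegCoeffs p → 0# ≤ weightedSum p w
    go []                 _        _   = 0≤0
    go p@((a , ν₀) ∷ p') (acc rec) p≥0 =
      0≤-respˡ-≈ (weightedSum-dropMonomial ν₀ p w w-resp)
        (0≤+ (*-nonneg (p≥0 ν₀) (w≥0 ν₀))
             (go (dropMonomial ν₀ p) (rec (dropMonomial-shorter a ν₀ p'))
                 (dropMonomial-preserves (0# ≤_) 0≤-respˡ-≈ 0≤0 ν₀ p p≥0)))

  weightedSum-congˡ : ∀ {p q} w → RespectsMonomial w → p ≋ q → weightedSum p w ≈ weightedSum q w
  weightedSum-congˡ {p} {q} w w-resp p≋q = x∙y⁻¹≈ε⇒x≈y _ _ (begin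
    weightedSum p w - weightedSum q w   ≈⟨ +-congˡ (weightedSum-neg q w) ⟨
    weightedSum p w + weightedSum (-ₚ q) w ≈⟨ weightedSum-++ p (-ₚ q) w ⟨
    weightedSum (p -ₚ q) w              ≈⟨ weightedSum-null (p -ₚ q) w w-resp p-q≈0 ⟩
    0#                                  ∎)
    where
    p-q≈0 : ∀ μ → coeff (p -ₚ q) μ ≈ 0#
    p-q≈0 μ = trans (coeff-++ p (-ₚ q) μ)
                (trans (+-cong (coeff-≈ p≋q μ) (coeff-neg q μ)) (-‿inverseʳ _))

  private
    productWeight : Polynomial → Monomial → Monomial → Carrier
    productWeight q μ ν = weightedSum q (λ ν' → indicator μ (monoMul ν ν'))

    productWeight-resp : ∀ q μ → RespectsMonomial (productWeight q μ)
    productWeight-resp q μ ν≃ν' = weightedSum-congʳ q (λ ν' → indicator-resp μ (monoMul-congˡ ν' ν≃ν'))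

  +ₚ-cong : ∀ {p p' q q'} → p ≋ p' → q ≋ q' → p +ₚ q ≋ p' +ₚ q'
  +ₚ-cong {p} {p'} {q} {q'} p≋p' q≋q' = mk≋ λ μ →
    trans (coeff-++ p q μ) (trans (+-cong (coeff-≈ p≋p' μ) (coeff-≈ q≋q' μ)) (sym (coeff-++ p' q' μ)))

  -ₚ-cong : ∀ {p p'} → p ≋ p' → -ₚ p ≋ -ₚ p'
  -ₚ-cong {p} {p'} p≋p' = mk≋ λ μ →
    trans (coeff-neg p μ) (trans (-‿cong (coeff-≈ p≋p' μ)) (sym (coeff-neg p' μ)))

  *ₚ-cong : ∀ {p p' q q'} → p ≋ p' → q ≋ q' → p *ₚ q ≋ p' *ₚ q'
  *ₚ-cong {p} {p'} {q} {q'} p≋p' q≋q' = mk≋ λ μ → begin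
    coeff (p *ₚ q) μ                ≈⟨ coeff-*ₚ p q μ ⟩
    weightedSum p (productWeight q μ)  ≈⟨ weightedSum-congˡ _ (productWeight-resp q μ) p≋p' ⟩
    weightedSum p' (productWeight q μ) ≈⟨ weightedSum-congʳ p' (λ ν →
      weightedSum-congˡ _ (λ e → indicator-resp μ (monoMul-congʳ ν e)) q≋q') ⟩
    weightedSum p' (productWeight q' μ) ≈⟨ coeff-*ₚ p' q' μ ⟨
    coeff (p' *ₚ q') μ              ∎

  +ₚ-assoc : ∀ p q r → (p +ₚ q) +ₚ r ≋ p +ₚ (q +ₚ r)
  +ₚ-assoc p q r = ≡⇒≋ (++-assoc p q r)

  +ₚ-comm : ∀ p q → p +ₚ q ≋ q +ₚ p
  +ₚ-comm p q = mk≋ λ μ → trans (coeff-++ p q μ) (trans (+-comm _ _) (sym (coeff-++ q p μ)))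

  +ₚ-identityʳ : ∀ p → p +ₚ 0ₚ ≋ p
  +ₚ-identityʳ p = ≡⇒≋ (++-identityʳ p)

  -ₚ-inverseʳ : ∀ p → p -ₚ p ≋ 0ₚ
  -ₚ-inverseʳ p = mk≋ λ μ →
    trans (coeff-++ p (-ₚ p) μ) (trans (+-congˡ (coeff-neg p μ)) (-‿inverseʳ _))

  *ₚ-comm : ∀ p q → p *ₚ q ≋ q *ₚ p
  *ₚ-comm p q = mk≋ λ μ → begin
    coeff (p *ₚ q) μ
      ≈⟨ coeff-*ₚ p q μ ⟩
    weightedSum p (λ ν → weightedSum q (λ ν' → indicator μ (monoMul ν ν')))
      ≈⟨ weightedSum-swap p q _ ⟩
    weightedSum q (λ ν' → weightedSum p (λ ν → indicator μ (monoMul ν ν')))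
      ≈⟨ weightedSum-congʳ q (λ ν' → weightedSum-congʳ p (λ ν →
           reflexive (cong (indicator μ) (monoMul-comm ν ν')))) ⟩
    weightedSum q (λ ν' → weightedSum p (λ ν → indicator μ (monoMul ν' ν)))
      ≈⟨ coeff-*ₚ q p μ ⟨
    coeff (q *ₚ p) μ ∎

  *ₚ-assoc : ∀ p q r → (p *ₚ q) *ₚ r ≋ p *ₚ (q *ₚ r)
  *ₚ-assoc p q r = mk≋ λ μ → begin
    coeff ((p *ₚ q) *ₚ r) μ
      ≈⟨ coeff-*ₚ (p *ₚ q) r μ ⟩
    weightedSum (p *ₚ q) (productWeight r μ)
      ≈⟨ weightedSum-*ₚ p q (productWeight r μ) ⟩
    weightedSum p (λ ν → weightedSum q (λ ν' → weightedSum r (λ ν'' →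
      indicator μ (monoMul (monoMul ν ν') ν''))))
      ≈⟨ weightedSum-congʳ p (λ ν → weightedSum-congʳ q (λ ν' → weightedSum-congʳ r (λ ν'' →
           reflexive (cong (indicator μ) (monoMul-assoc ν ν' ν''))))) ⟩
    weightedSum p (λ ν → weightedSum q (λ ν' → weightedSum r (λ ν'' →
      indicator μ (monoMul ν (monoMul ν' ν'')))))
      ≈⟨ weightedSum-congʳ p (λ ν → weightedSum-*ₚ q r (λ ν' → indicator μ (monoMul ν ν'))) ⟨
    weightedSum p (productWeight (q *ₚ r) μ)
      ≈⟨ coeff-*ₚ p (q *ₚ r) μ ⟨
    coeff (p *ₚ (q *ₚ r)) μ ∎

  *ₚ-identityˡ : ∀ p → 1ₚ *ₚ p ≋ p
  *ₚ-identityˡ p = mk≋ λ μ → begin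
    coeff (1ₚ *ₚ p) μ                      ≈⟨ coeff-*ₚ 1ₚ p μ ⟩
    1# * weightedSum p (indicator μ) + 0#  ≈⟨ trans (+-identityʳ _) (*-identityˡ _) ⟩
    weightedSum p (indicator μ)            ≈⟨ coeff≈weightedSum-indicator p μ ⟨
    coeff p μ                              ∎

  *ₚ-distribʳ : ∀ p q r → (q +ₚ r) *ₚ p ≋ (q *ₚ p) +ₚ (r *ₚ p)
  *ₚ-distribʳ p q r = mk≋ λ μ → begin
    coeff ((q +ₚ r) *ₚ p) μ
      ≈⟨ coeff-*ₚ (q +ₚ r) p μ ⟩
    weightedSum (q +ₚ r) (productWeight p μ)
      ≈⟨ weightedSum-++ q r _ ⟩
    weightedSum q (productWeight p μ) + weightedSum r (productWeight p μ)
      ≈⟨ +-cong (coeff-*ₚ q p μ) (coeff-*ₚ r p μ) ⟨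
    coeff (q *ₚ p) μ + coeff (r *ₚ p) μ
      ≈⟨ coeff-++ (q *ₚ p) (r *ₚ p) μ ⟨
    coeff ((q *ₚ p) +ₚ (r *ₚ p)) μ ∎

  polyRing : CommutativeRing c ℓ₁
  polyRing = record
    { Carrier = Polynomial
    ; _≈_ = _≋_
    ; _+_ = _+ₚ_
    ; _*_ = _*ₚ_
    ; -_ = -ₚ_
    ; 0# = 0ₚ
    ; 1# = 1ₚ
    ; isCommutativeRing = polyIsCommutativeRing
    }
    where
    polyIsCommutativeRing : IsCommutativeRing _≋_ _+ₚ_ _*ₚ_ -ₚ_ 0ₚ 1ₚ
    polyIsCommutativeRing = record
      { isRing = record
        { +-isAbelianGroup = record
          { isGroup = record
            { isMonoid = record
              { isSemigroup = record
                { isMagma = record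
                  { isEquivalence = record { refl = ≋-refl ; sym = ≋-sym ; trans = ≋-trans }
                  ; ∙-cong = +ₚ-cong }
                ; assoc = +ₚ-assoc }
              ; identity = (λ _ → ≋-refl) , +ₚ-identityʳ }
            ; inverse = (λ p → ≋-trans (+ₚ-comm (-ₚ p) p) (-ₚ-inverseʳ p)) , -ₚ-inverseʳ
            ; ⁻¹-cong = -ₚ-cong }
          ; comm = +ₚ-comm }
        ; *-cong = *ₚ-cong
        ; *-assoc = *ₚ-assoc
        ; *-identity = *ₚ-identityˡ , (λ p → ≋-trans (*ₚ-comm p 1ₚ) (*ₚ-identityˡ p))
        ; distrib = (λ p q r → ≋-trans (*ₚ-comm p (q +ₚ r)) (≋-trans (*ₚ-distribʳ p q r)
                      (+ₚ-cong (*ₚ-comm q p) (*ₚ-comm r p))))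
                  , *ₚ-distribʳ }
      ; *-comm = *ₚ-comm }

  *ₚ-nullˡ : ∀ {p} q → p ≋ 0ₚ → p *ₚ q ≋ 0ₚ
  *ₚ-nullˡ {p} q p≋0 = ≋-trans (*ₚ-cong p≋0 (≋-refl {q})) (CommutativeRing.zeroˡ polyRing q)

  *ₚ-nullʳ : ∀ p {q} → q ≋ 0ₚ → p *ₚ q ≋ 0ₚ
  *ₚ-nullʳ p {q} q≋0 = ≋-trans (*ₚ-cong (≋-refl {p}) q≋0) (CommutativeRing.zeroʳ polyRing p)

  nonneg-resp : ∀ {p q} → p ≋ q → NonnegCoeffs q → NonnegCoeffs p
  nonneg-resp p≋q q≥0 μ = 0≤-respˡ-≈ (coeff-≈ p≋q μ) (q≥0 μ)

  nonneg-0ₚ : NonnegCoeffs 0ₚ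
  nonneg-0ₚ μ = 0≤0

  nonneg-1ₚ : NonnegCoeffs 1ₚ
  nonneg-1ₚ μ = 0≤+ (indicator-nonneg μ []) 0≤0

  nonneg-+ₚ : ∀ {p q} → NonnegCoeffs p → NonnegCoeffs q → NonnegCoeffs (p +ₚ q)
  nonneg-+ₚ {p} {q} p≥0 q≥0 μ = 0≤-respˡ-≈ (coeff-++ p q μ) (0≤+ (p≥0 μ) (q≥0 μ))

  nonneg-*ₚ : ∀ {p q} → NonnegCoeffs p → NonnegCoeffs q → NonnegCoeffs (p *ₚ q)
  nonneg-*ₚ {p} {q} p≥0 q≥0 μ = 0≤-respˡ-≈ (coeff-*ₚ p q μ)
    (weightedSum-nonneg p _ (productWeight-resp q μ)
      (λ ν → weightedSum-nonneg q _ (λ e → indicator-resp μ (monoMul-congʳ ν e))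
               (λ ν' → indicator-nonneg μ (monoMul ν ν')) q≥0)
      p≥0)

module IntegerCoefficientSolver {a ℓ} (R : CommutativeRing a ℓ) where
  open CommutativeRing R
  open import Algebra.Properties.Semiring.Mult semiring using (×-homo-+; ×1-homo-*; ×-congˡ)
    renaming (_×_ to _×ₙ_)
  open import Algebra.Properties.Ring ring using (-‿distribˡ-*; -‿distribʳ-*)
  open import Algebra.Properties.AbelianGroup +-abelianGroup using (⁻¹-∙-comm)
  open import Algebra.Properties.Group +-group using (ε⁻¹≈ε; ⁻¹-involutive)
  open import Relation.Binary.Reasoning.Setoid setoid

  ⟦_⟧ℕ : ℕ → Carrier
  ⟦ n ⟧ℕ = n ×ₙ 1#

  ⟦_⟧ℤ : ℤ → Carrier
  ⟦ + n ⟧ℤ      = ⟦ n ⟧ℕ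
  ⟦ -[1+ n ] ⟧ℤ = - ⟦ suc n ⟧ℕ

  ⟦⟧ℤ-neg : ∀ i → ⟦ ℤ.- i ⟧ℤ ≈ - ⟦ i ⟧ℤ
  ⟦⟧ℤ-neg -[1+ n ]    = sym (⁻¹-involutive _)
  ⟦⟧ℤ-neg (+ zero)    = sym ε⁻¹≈ε
  ⟦⟧ℤ-neg (+ (suc n)) = refl

  ⟦⟧ℤ-⊖ : ∀ m n → ⟦ m ⊖ n ⟧ℤ ≈ ⟦ m ⟧ℕ - ⟦ n ⟧ℕ
  ⟦⟧ℤ-⊖ zero    zero    = sym (trans (+-congˡ ε⁻¹≈ε) (+-identityʳ 0#))
  ⟦⟧ℤ-⊖ zero    (suc n) = sym (+-identityˡ _)
  ⟦⟧ℤ-⊖ (suc m) zero    = sym (trans (+-congˡ ε⁻¹≈ε) (+-identityʳ _))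
  ⟦⟧ℤ-⊖ (suc m) (suc n) = begin
    ⟦ suc m ⊖ suc n ⟧ℤ                ≡⟨ cong ⟦_⟧ℤ (ℤₚ.[1+m]⊖[1+n]≡m⊖n m n) ⟩
    ⟦ m ⊖ n ⟧ℤ                        ≈⟨ ⟦⟧ℤ-⊖ m n ⟩
    ⟦ m ⟧ℕ - ⟦ n ⟧ℕ                   ≈⟨ +-congˡ (+-identityˡ _) ⟨
    ⟦ m ⟧ℕ + (0# - ⟦ n ⟧ℕ)            ≈⟨ +-congˡ (+-congʳ (-‿inverseʳ 1#)) ⟨
    ⟦ m ⟧ℕ + ((1# - 1#) - ⟦ n ⟧ℕ)     ≈⟨ +-congˡ (+-assoc _ _ _) ⟩
    ⟦ m ⟧ℕ + (1# + (- 1# - ⟦ n ⟧ℕ))   ≈⟨ +-assoc _ _ _ ⟨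
    (⟦ m ⟧ℕ + 1#) + (- 1# - ⟦ n ⟧ℕ)   ≈⟨ +-cong (+-comm _ _) (⁻¹-∙-comm _ _) ⟩
    ⟦ suc m ⟧ℕ - ⟦ suc n ⟧ℕ           ∎

  ⟦⟧ℤ-+ : ∀ i j → ⟦ i ℤ.+ j ⟧ℤ ≈ ⟦ i ⟧ℤ + ⟦ j ⟧ℤ
  ⟦⟧ℤ-+ -[1+ m ] -[1+ n ] = begin
    - ⟦ suc (suc (m ℕ.+ n)) ⟧ℕ       ≈⟨ -‿cong (×-congˡ (≡.sym (ℕₚ.+-suc (suc m) n))) ⟩
    - ⟦ suc m ℕ.+ suc n ⟧ℕ           ≈⟨ -‿cong (×-homo-+ 1# (suc m) (suc n)) ⟩
    - (⟦ suc m ⟧ℕ + ⟦ suc n ⟧ℕ)      ≈⟨ ⁻¹-∙-comm _ _ ⟨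
    - ⟦ suc m ⟧ℕ - ⟦ suc n ⟧ℕ        ∎
  ⟦⟧ℤ-+ -[1+ m ] (+ n)    = trans (⟦⟧ℤ-⊖ n (suc m)) (+-comm _ _)
  ⟦⟧ℤ-+ (+ m)    -[1+ n ] = ⟦⟧ℤ-⊖ m (suc n)
  ⟦⟧ℤ-+ (+ m)    (+ n)    = ×-homo-+ 1# m n

  ⟦⟧ℤ-* : ∀ i j → ⟦ i ℤ.* j ⟧ℤ ≈ ⟦ i ⟧ℤ * ⟦ j ⟧ℤ
  ⟦⟧ℤ-* -[1+ m ] -[1+ n ] = trans (reflexive (cong ⟦_⟧ℤ (ℤₚ.+◃n≡+n (suc m ℕ.* suc n))))
    (trans (×1-homo-* (suc m) (suc n)) (sym neg*neg))
    where
    neg*neg : (- ⟦ suc m ⟧ℕ) * (- ⟦ suc n ⟧ℕ) ≈ ⟦ suc m ⟧ℕ * ⟦ suc n ⟧ℕ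
    neg*neg = trans (sym (-‿distribˡ-* _ _)) (trans (-‿cong (sym (-‿distribʳ-* _ _))) (⁻¹-involutive _))
  ⟦⟧ℤ-* -[1+ m ] (+ n)    = trans (neg◃ (suc m ℕ.* n))
    (trans (-‿cong (×1-homo-* (suc m) n)) (-‿distribˡ-* _ _))
    where
    neg◃ : ∀ k → ⟦ Sign.- ℤ.◃ k ⟧ℤ ≈ - ⟦ k ⟧ℕ
    neg◃ k = trans (reflexive (cong ⟦_⟧ℤ (ℤₚ.-◃n≡-n k))) (⟦⟧ℤ-neg (+ k))
  ⟦⟧ℤ-* (+ m)    -[1+ n ] = trans (neg◃ (m ℕ.* suc n))
    (trans (-‿cong (×1-homo-* m (suc n))) (-‿distribʳ-* _ _))
    where
    neg◃ : ∀ k → ⟦ Sign.- ℤ.◃ k ⟧ℤ ≈ - ⟦ k ⟧ℕ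
    neg◃ k = trans (reflexive (cong ⟦_⟧ℤ (ℤₚ.-◃n≡-n k))) (⟦⟧ℤ-neg (+ k))
  ⟦⟧ℤ-* (+ m)    (+ n)    = trans (reflexive (cong ⟦_⟧ℤ (ℤₚ.+◃n≡+n (m ℕ.* n)))) (×1-homo-* m n)

  ℤ⟶R : ℤ.+-*-rawRing -Raw-AlmostCommutative⟶ fromCommutativeRing R
  ℤ⟶R = record
    { ⟦_⟧    = ⟦_⟧ℤ
    ; +-homo = ⟦⟧ℤ-+
    ; *-homo = ⟦⟧ℤ-*
    ; -‿homo = ⟦⟧ℤ-neg
    ; 0-homo = refl
    ; 1-homo = +-identityʳ 1#
    }

  ⟦⟧ℤ-≟ : ∀ i j → Maybe (⟦ i ⟧ℤ ≈ ⟦ j ⟧ℤ)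
  ⟦⟧ℤ-≟ i j with i ℤₚ.≟ j
  ... | yes ≡.refl = just refl
  ... | no  _      = nothing

  open import Algebra.Solver.Ring ℤ.+-*-rawRing (fromCommutativeRing R) ℤ⟶R ⟦⟧ℤ-≟ public

module Determinants {c ℓ₁ ℓ₂} (O : OrderedCommRing c ℓ₁ ℓ₂) where
  open Poly O
  open PolynomialRing O
  private module P = CommutativeRing polyRing

  signed-cong : ∀ n {p q} → p ≋ q → signed n p ≋ signed n q
  signed-cong zero          p≋q = p≋q
  signed-cong (suc zero)    p≋q = -ₚ-cong p≋q
  signed-cong (suc (suc n)) p≋q = signed-cong n p≋q

  signed-null : ∀ n {p} → p ≋ 0ₚ → signed n p ≋ 0ₚ
  signed-null zero          p≋0 = p≋0
  signed-null (suc zero)    p≋0 = -ₚ-cong p≋0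
  signed-null (suc (suc n)) p≋0 = signed-null n p≋0

  sumFin-cong : ∀ {n} {f g : Fin n → Polynomial} → (∀ j → f j ≋ g j) → sumFin f ≋ sumFin g
  sumFin-cong {zero}  f≋g = ≋-refl
  sumFin-cong {suc n} f≋g = +ₚ-cong (f≋g zero) (sumFin-cong (f≋g ∘ suc))

  sumFin-null : ∀ {n} (f : Fin n → Polynomial) → (∀ j → f j ≋ 0ₚ) → sumFin f ≋ 0ₚ
  sumFin-null {zero}  f f≋0 = ≋-refl
  sumFin-null {suc n} f f≋0 = +ₚ-cong (f≋0 zero) (sumFin-null (f ∘ suc) (f≋0 ∘ suc))

  det-cong : ∀ {k} (M M' : Fin k → Fin k → Polynomial) → (∀ r s → M r s ≋ M' r s) → det M ≋ det M'
  det-cong {zero}  M M' M≋M' = ≋-refl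
  det-cong {suc k} M M' M≋M' = sumFin-cong λ j → signed-cong (toℕ j)
    (*ₚ-cong (M≋M' zero j) (det-cong _ _ (λ r s → M≋M' (suc r) (punchIn j s))))

  det-zeroColumn : ∀ {k} (M : Fin k → Fin k → Polynomial) c → (∀ r → M r c ≋ 0ₚ) → det M ≋ 0ₚ
  det-zeroColumn {suc k} M c col≋0 = sumFin-null _ λ j → signed-null (toℕ j) (term j)
    where
    minorAt : Fin (suc k) → Polynomial
    minorAt j = det (λ r s → M (suc r) (punchIn j s))

    term : ∀ j → (M zero j *ₚ minorAt j) ≋ 0ₚ
    term j with j Finₚ.≟ c
    ... | yes ≡.refl = ≋-trans (*ₚ-cong (col≋0 zero) (≋-refl {minorAt j})) (P.zeroˡ (minorAt j))
    ... | no  j≢c    = ≋-trans (*ₚ-cong (≋-refl {M zero j}) (det-zeroColumn _ (punchOut j≢c) λ r →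
            ≡.subst (λ x → M (suc r) x ≋ 0ₚ) (≡.sym (Finₚ.punchIn-punchOut j≢c)) (col≋0 (suc r))))
          (P.zeroʳ (M zero j))

module Continuant {c ℓ₁ ℓ₂} (O : OrderedCommRing c ℓ₁ ℓ₂) where
  open Poly O

  continuant : (d β : ℕ → Polynomial) → ℕ → ℕ → Polynomial
  continuant d β i zero          = 1ₚ
  continuant d β i (suc zero)    = d i
  continuant d β i (suc (suc n)) =
    (d i *ₚ continuant d β (suc i) (suc n)) -ₚ (β i *ₚ continuant d β (suc (suc i)) n)

module IncreasingIndices where

  Increasing : ℕ → (ℕ → ℕ) → Set
  Increasing k I = ∀ n → suc n ℕ.< k → I n ℕ.< I (suc n)

  Increasing-≥ : ∀ {k I} → Increasing k I → ∀ n → n ℕ.< k → I 0 ℕ.+ n ℕ.≤ I n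
  Increasing-≥ inc zero    _   = ℕₚ.≤-reflexive (ℕₚ.+-identityʳ _)
  Increasing-≥ {I = I} inc (suc n) n<k = ℕₚ.≤-trans (ℕₚ.≤-reflexive (ℕₚ.+-suc (I 0) n))
    (ℕₚ.≤-trans (s≤s (Increasing-≥ inc n (ℕₚ.<-trans (ℕₚ.n<1+n n) n<k))) (inc n n<k))

  Increasing-tail : ∀ {k I} → Increasing (suc k) I → Increasing k (I ∘ suc)
  Increasing-tail inc n n<k = inc (suc n) (s≤s n<k)

  Increasing-drop : ∀ t {k I} → Increasing (t ℕ.+ k) I → Increasing k (λ n → I (t ℕ.+ n))
  Increasing-drop zero    inc = inc
  Increasing-drop (suc t) inc = Increasing-drop t (Increasing-tail inc)

  Increasing-< : ∀ {k I} → Increasing k I → ∀ n → suc n ℕ.< k → I 0 ℕ.< I (suc n)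
  Increasing-< {I = I} inc n lt = ℕₚ.≤-trans (s≤s (ℕₚ.m≤m+n (I 0) n))
    (ℕₚ.≤-trans (ℕₚ.≤-reflexive (≡.sym (ℕₚ.+-suc (I 0) n))) (Increasing-≥ inc (suc n) lt))

  Increasing-gap : ∀ {k I} → Increasing k I → ∀ n → suc (suc n) ℕ.< k →
    2 ℕ.+ I 0 ℕ.≤ I (suc (suc n))
  Increasing-gap {I = I} inc n lt =
    ℕₚ.≤-trans (2+m≤m+[2+n] (I 0)) (Increasing-≥ inc (suc (suc n)) lt)
    where
    2+m≤m+[2+n] : ∀ m → 2 ℕ.+ m ℕ.≤ m ℕ.+ suc (suc n)
    2+m≤m+[2+n] m = ℕₚ.≤-trans (ℕₚ.≤-reflexive (ℕₚ.+-comm 2 m)) (ℕₚ.+-monoʳ-≤ m (s≤s (s≤s z≤n)))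

module TridiagonalMinors {c ℓ₁ ℓ₂} (O : OrderedCommRing c ℓ₁ ℓ₂)
  (d u l : ℕ → Poly.Polynomial O) where
  open Poly O
  open PolynomialRing O
  open Determinants O
  open Continuant O
  open IncreasingIndices
  open IntegerCoefficientSolver polyRing using (solve; _:=_; _:+_; _:*_; _:-_)
  private module P = CommutativeRing polyRing
  open import Relation.Binary.Reasoning.Setoid P.setoid

  T : InfMatrix
  T = tridiag d u l

  tridiag-diag : ∀ i j → i ≡ j → T i j ≡ d i
  tridiag-diag i j i≡j with ℕ.compare i j
  ... | ℕ.less .i k    = ⊥-elim (ℕₚ.m≢1+m+n i i≡j)
  ... | ℕ.equal .i     = ≡.refl
  ... | ℕ.greater .j k = ⊥-elim (ℕₚ.m≢1+m+n j (≡.sym i≡j))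

  tridiag-super : ∀ i j → j ≡ suc i → T i j ≡ u i
  tridiag-super i j j≡1+i with ℕ.compare i j
  ... | ℕ.less .i zero    = ≡.refl
  ... | ℕ.less .i (suc k) =
    ⊥-elim (ℕₚ.m≢1+m+n i (≡.sym (≡.trans (≡.sym (ℕₚ.+-suc i k)) (ℕₚ.suc-injective j≡1+i))))
  ... | ℕ.equal .i        = ⊥-elim (ℕₚ.1+n≢n (≡.sym j≡1+i))
  ... | ℕ.greater .j k    =
    ⊥-elim (ℕₚ.m≢1+m+n j {suc k} (≡.trans j≡1+i (cong suc (≡.sym (ℕₚ.+-suc j k)))))

  tridiag-sub : ∀ i j → i ≡ suc j → T i j ≡ l j
  tridiag-sub i j i≡1+j with ℕ.compare i j
  ... | ℕ.less .i k          =
    ⊥-elim (ℕₚ.m≢1+m+n i {suc k} (≡.trans i≡1+j (cong suc (≡.sym (ℕₚ.+-suc i k)))))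
  ... | ℕ.equal .i           = ⊥-elim (ℕₚ.1+n≢n (≡.sym i≡1+j))
  ... | ℕ.greater .j zero    = ≡.refl
  ... | ℕ.greater .j (suc k) =
    ⊥-elim (ℕₚ.m≢1+m+n j (≡.sym (≡.trans (≡.sym (ℕₚ.+-suc j k)) (ℕₚ.suc-injective i≡1+j))))

  tridiag-above : ∀ i j → 2 ℕ.+ i ℕ.≤ j → T i j ≡ 0ₚ
  tridiag-above i j i+2≤j with ℕ.compare i j
  ... | ℕ.less .i zero    =
    ⊥-elim (ℕₚ.1+n≰n (ℕₚ.≤-trans (ℕ.s≤s⁻¹ i+2≤j) (ℕₚ.≤-reflexive (ℕₚ.+-identityʳ i))))
  ... | ℕ.less .i (suc k) = ≡.refl
  ... | ℕ.equal .i        = ⊥-elim (ℕₚ.1+n≰n (ℕₚ.m+n≤o⇒n≤o 1 i+2≤j))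
  ... | ℕ.greater .j k    = ⊥-elim (ℕₚ.m+n≮m j k (ℕₚ.m+n≤o⇒n≤o 2 i+2≤j))

  tridiag-below : ∀ i j → 2 ℕ.+ j ℕ.≤ i → T i j ≡ 0ₚ
  tridiag-below i j j+2≤i with ℕ.compare i j
  ... | ℕ.less .i k          = ⊥-elim (ℕₚ.m+n≮m i k (ℕₚ.m+n≤o⇒n≤o 2 j+2≤i))
  ... | ℕ.equal .i           = ⊥-elim (ℕₚ.1+n≰n (ℕₚ.m+n≤o⇒n≤o 1 j+2≤i))
  ... | ℕ.greater .j zero    =
    ⊥-elim (ℕₚ.1+n≰n (ℕₚ.≤-trans (ℕ.s≤s⁻¹ j+2≤i) (ℕₚ.≤-reflexive (ℕₚ.+-identityʳ j))))
  ... | ℕ.greater .j (suc k) = ≡.refl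

  minorℕ : ℕ → (ℕ → ℕ) → (ℕ → ℕ) → Polynomial
  minorℕ k I J = minor T {k} (I ∘ toℕ) (J ∘ toℕ)

  -- minorℕ (suc k) I J unfolds to firstRowTerm k I J zero +ₚ sumFin (λ s → firstRowTerm k I J (suc s)).
  private
    subMinor : ∀ k (I J : ℕ → ℕ) → Fin (suc k) → Polynomial
    subMinor k I J s = det (λ r s' → T (I (suc (toℕ r))) (J (toℕ (punchIn s s'))))

    firstRowTerm : ∀ k (I J : ℕ → ℕ) → Fin (suc k) → Polynomial
    firstRowTerm k I J s = signed (toℕ s) (T (I 0) (J (toℕ s)) *ₚ subMinor k I J s)

    firstRowTerm-zeroEntry : ∀ k I J s → T (I 0) (J (toℕ s)) ≡ 0ₚ → firstRowTerm k I J s ≋ 0ₚ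
    firstRowTerm-zeroEntry k I J s e = signed-null (toℕ s) (*ₚ-nullˡ (subMinor k I J s) (≡⇒≋ e))

    firstRowTerm-zeroColumn : ∀ k I J → (∀ (r : Fin k) → 2 ℕ.+ J 0 ℕ.≤ I (suc (toℕ r))) →
      ∀ s → firstRowTerm k I J (suc s) ≋ 0ₚ
    firstRowTerm-zeroColumn zero    I J far ()
    firstRowTerm-zeroColumn (suc k) I J far s = signed-null (suc (toℕ s))
      (*ₚ-nullʳ (T (I 0) (J (suc (toℕ s))))
        (det-zeroColumn (λ r s' → T (I (suc (toℕ r))) (J (toℕ (punchIn (suc s) s')))) zero λ r →
          ≡⇒≋ (tridiag-below (I (suc (toℕ r))) (J 0) (far r))))

    minor-firstEntryOnly : ∀ k I J {x} → T (I 0) (J 0) ≡ x →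
      sumFin (λ s → firstRowTerm k I J (suc s)) ≋ 0ₚ →
      minorℕ (suc k) I J ≋ (x *ₚ minorℕ k (I ∘ suc) (J ∘ suc))
    minor-firstEntryOnly k I J e rest≋0 =
      ≋-trans (+ₚ-cong (*ₚ-cong (≡⇒≋ e) (≋-refl {minorℕ k (I ∘ suc) (J ∘ suc)})) rest≋0)
        (+ₚ-identityʳ _)

    firstRow-beyondSecond : ∀ k I J → J 0 ≡ I 0 → Increasing (2 ℕ.+ k) J →
      sumFin (λ s → firstRowTerm (suc k) I J (suc (suc s))) ≋ 0ₚ
    firstRow-beyondSecond k I J J0≡I0 J-inc = sumFin-null (λ s → firstRowTerm (suc k) I J (suc (suc s))) λ s →
      firstRowTerm-zeroEntry (suc k) I J (suc (suc s)) (tridiag-above (I 0) _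
        (ℕₚ.≤-trans (ℕₚ.≤-reflexive (cong (2 ℕ.+_) (≡.sym J0≡I0)))
          (Increasing-gap J-inc (toℕ s) (s≤s (s≤s (Finₚ.toℕ<n s))))))

  minor-aboveDiagonal : ∀ k I J → 2 ℕ.+ I 0 ℕ.≤ J 0 → Increasing (suc k) J →
    minorℕ (suc k) I J ≋ 0ₚ
  minor-aboveDiagonal k I J far J-inc = sumFin-null (firstRowTerm k I J) λ s →
    firstRowTerm-zeroEntry k I J s (tridiag-above (I 0) _ (ℕₚ.≤-trans far
      (ℕₚ.≤-trans (ℕₚ.m≤m+n (J 0) (toℕ s)) (Increasing-≥ J-inc (toℕ s) (Finₚ.toℕ<n s)))))

  minor-belowDiagonal : ∀ k I J → 2 ℕ.+ J 0 ℕ.≤ I 0 → Increasing (suc k) I →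
    minorℕ (suc k) I J ≋ 0ₚ
  minor-belowDiagonal k I J far I-inc = det-zeroColumn (λ r s → T (I (toℕ r)) (J (toℕ s))) zero λ r →
    ≡⇒≋ (tridiag-below (I (toℕ r)) (J 0) (ℕₚ.≤-trans far
      (ℕₚ.≤-trans (ℕₚ.m≤m+n (I 0) (toℕ r)) (Increasing-≥ I-inc (toℕ r) (Finₚ.toℕ<n r)))))

  minor-superStart : ∀ k I J → J 0 ≡ suc (I 0) → Increasing (suc k) J →
    minorℕ (suc k) I J ≋ (u (I 0) *ₚ minorℕ k (I ∘ suc) (J ∘ suc))
  minor-superStart k I J J0≡1+I0 J-inc =
    minor-firstEntryOnly k I J (tridiag-super (I 0) (J 0) J0≡1+I0)
      (sumFin-null (λ s → firstRowTerm k I J (suc s)) λ s →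
      firstRowTerm-zeroEntry k I J (suc s) (tridiag-above (I 0) _
        (ℕₚ.≤-trans (s≤s (ℕₚ.≤-reflexive (≡.sym J0≡1+I0)))
          (Increasing-< J-inc (toℕ s) (s≤s (Finₚ.toℕ<n s))))))

  minor-subStart : ∀ k I J → I 0 ≡ suc (J 0) → Increasing (suc k) I →
    minorℕ (suc k) I J ≋ (l (J 0) *ₚ minorℕ k (I ∘ suc) (J ∘ suc))
  minor-subStart k I J I0≡1+J0 I-inc =
    minor-firstEntryOnly k I J (tridiag-sub (I 0) (J 0) I0≡1+J0)
      (sumFin-null (λ s → firstRowTerm k I J (suc s)) (firstRowTerm-zeroColumn k I J λ r →
        ℕₚ.≤-trans (s≤s (ℕₚ.≤-reflexive (≡.sym I0≡1+J0)))
          (Increasing-< I-inc (toℕ r) (s≤s (Finₚ.toℕ<n r)))))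

  OnDiagonal : ℕ → (I J : ℕ → ℕ) → ℕ → Set
  OnDiagonal i I J s = I s ≡ i ℕ.+ s × J s ≡ i ℕ.+ s

  OnDiagonal? : ∀ i I J s → Dec (OnDiagonal i I J s)
  OnDiagonal? i I J s = (I s ℕ.≟ i ℕ.+ s) ×-dec (J s ℕ.≟ i ℕ.+ s)

  DiagonalPrefix : ℕ → (I J : ℕ → ℕ) → ℕ → Set
  DiagonalPrefix t I J i = ∀ s → s ℕ.< t → OnDiagonal i I J s

  RunEnds : ℕ → ℕ → (I J : ℕ → ℕ) → ℕ → Set
  RunEnds t k I J i = ∀ {k'} → k ≡ suc k' → ¬ OnDiagonal i I J t

  private
    firstRow-second-offDiagonal : ∀ k I J i → I 0 ≡ i → J 0 ≡ i →
      Increasing (2 ℕ.+ k) I → Increasing (2 ℕ.+ k) J → ¬ OnDiagonal i I J 1 →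
      firstRowTerm (suc k) I J (suc zero) ≋ 0ₚ
    firstRow-second-offDiagonal k I J i I0≡i J0≡i I-inc J-inc off with J 1 ℕ.≟ suc i
    ... | yes J1≡1+i = firstRowTerm-zeroColumn (suc k) I J far (zero)
      where
      I1≢1+i : I 1 ≢ suc i
      I1≢1+i I1≡1+i = off (≡.trans I1≡1+i (ℕₚ.+-comm 1 i) , ≡.trans J1≡1+i (ℕₚ.+-comm 1 i))
      far : ∀ (r : Fin (suc k)) → 2 ℕ.+ J 0 ℕ.≤ I (suc (toℕ r))
      far r = ℕₚ.≤-trans (ℕₚ.≤-reflexive (cong (2 ℕ.+_) J0≡i))
        (ℕₚ.≤-trans (ℕₚ.≤∧≢⇒< (≡.subst (ℕ._< I 1) I0≡i (I-inc 0 (s≤s (s≤s z≤n))))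
                                (I1≢1+i ∘ ≡.sym))
          (ℕₚ.≤-trans (ℕₚ.m≤m+n (I 1) (toℕ r))
            (Increasing-≥ (Increasing-tail I-inc) (toℕ r) (Finₚ.toℕ<n r))))
    ... | no J1≢1+i = firstRowTerm-zeroEntry (suc k) I J (suc zero) (tridiag-above (I 0) (J 1)
      (ℕₚ.≤-trans (ℕₚ.≤-reflexive (cong (2 ℕ.+_) I0≡i))
        (ℕₚ.≤∧≢⇒< (≡.subst (ℕ._< J 1) J0≡i (J-inc 0 (s≤s (s≤s z≤n)))) (J1≢1+i ∘ ≡.sym))))

    diagonalEntry : ∀ (I J : ℕ → ℕ) i → I 0 ≡ i → J 0 ≡ i → T (I 0) (J 0) ≡ d i
    diagonalEntry I J i I0≡i J0≡i = ≡.trans (tridiag-diag (I 0) (J 0) (≡.trans I0≡i (≡.sym J0≡i))) (cong d I0≡i)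

  minor-diagStart : ∀ k I J i → I 0 ≡ i → J 0 ≡ i →
    Increasing (suc k) I → Increasing (suc k) J → RunEnds 1 k I J i →
    minorℕ (suc k) I J ≋ (d i *ₚ minorℕ k (I ∘ suc) (J ∘ suc))
  minor-diagStart k I J i I0≡i J0≡i I-inc J-inc ends =
    minor-firstEntryOnly k I J (diagonalEntry I J i I0≡i J0≡i) (rest k I-inc J-inc ends)
    where
    rest : ∀ k → Increasing (suc k) I → Increasing (suc k) J → RunEnds 1 k I J i →
      sumFin (λ s → firstRowTerm k I J (suc s)) ≋ 0ₚ
    rest zero     _     _     _    = ≋-refl
    rest (suc k) I-inc J-inc ends =
      +ₚ-cong (firstRow-second-offDiagonal k I J i I0≡i J0≡i I-inc J-inc (ends ≡.refl))
              (firstRow-beyondSecond k I J (≡.trans J0≡i (≡.sym I0≡i)) J-inc)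

  removeSecond : (ℕ → ℕ) → ℕ → ℕ
  removeSecond J zero    = J 0
  removeSecond J (suc n) = J (suc (suc n))

  minor-diagPair : ∀ k I J i → I 0 ≡ i → J 0 ≡ i → OnDiagonal i I J 1 →
    Increasing (2 ℕ.+ k) I → Increasing (2 ℕ.+ k) J →
    minorℕ (2 ℕ.+ k) I J ≋
      ((d i *ₚ minorℕ (suc k) (I ∘ suc) (J ∘ suc))
        -ₚ (u i *ₚ (l i *ₚ minorℕ k (λ n → I (suc (suc n))) (λ n → J (suc (suc n))))))
  minor-diagPair k I J i I0≡i J0≡i (I1≡i+1 , J1≡i+1) I-inc J-inc =
    +ₚ-cong {q = (-ₚ secondTerm) +ₚ beyond} (*ₚ-cong (≡⇒≋ (diagonalEntry I J i I0≡i J0≡i)) (≋-refl {M₁}))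
      (≋-trans {q = (-ₚ (u i *ₚ (l i *ₚ M₂))) +ₚ 0ₚ}
        (+ₚ-cong (-ₚ-cong second) (firstRow-beyondSecond k I J (≡.trans J0≡i (≡.sym I0≡i)) J-inc))
        (+ₚ-identityʳ _))
    where
    M₁ M₂ secondTerm beyond : Polynomial
    M₁ = minorℕ (suc k) (I ∘ suc) (J ∘ suc)
    M₂ = minorℕ k (λ n → I (suc (suc n))) (λ n → J (suc (suc n)))
    secondTerm = T (I 0) (J 1) *ₚ subMinor (suc k) I J (suc zero)
    beyond = sumFin (λ s → firstRowTerm (suc k) I J (suc (suc s)))

    second-minor : subMinor (suc k) I J (suc zero) ≋ minorℕ (suc k) (I ∘ suc) (removeSecond J)
    second-minor = det-cong {suc k} (λ r s → T (I (suc (toℕ r))) (J (toℕ (punchIn (suc zero) s))))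
                            (λ r s → T (I (suc (toℕ r))) (removeSecond J (toℕ s))) λ where
      r zero    → ≋-refl
      r (suc s) → ≋-refl

    second : secondTerm ≋ (u i *ₚ (l i *ₚ M₂))
    second = *ₚ-cong (≡⇒≋ (≡.trans (tridiag-super (I 0) (J 1)
                                      (≡.trans J1≡i+1 (≡.trans (ℕₚ.+-comm i 1) (cong suc (≡.sym I0≡i)))))
                                   (cong u I0≡i)))
      (≋-trans second-minor
        (≋-trans (minor-subStart k (I ∘ suc) (removeSecond J)
                    (≡.trans I1≡i+1 (≡.trans (ℕₚ.+-comm i 1) (cong suc (≡.sym J0≡i))))
                    (Increasing-tail I-inc))
          (*ₚ-cong (≡⇒≋ (cong l J0≡i)) (≋-refl {M₂}))))

  β : ℕ → Polynomial
  β i = u i *ₚ l i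

  private
    OnDiagonal-tail : ∀ {i} I J {s} → OnDiagonal i I J (suc s) →
      OnDiagonal (suc i) (I ∘ suc) (J ∘ suc) s
    OnDiagonal-tail {i} I J {s} (I≡ , J≡) = ≡.trans I≡ (ℕₚ.+-suc i s) , ≡.trans J≡ (ℕₚ.+-suc i s)

    OnDiagonal-untail : ∀ {i} I J {s} → OnDiagonal (suc i) (I ∘ suc) (J ∘ suc) s →
      OnDiagonal i I J (suc s)
    OnDiagonal-untail {i} I J {s} (I≡ , J≡) =
      ≡.trans I≡ (≡.sym (ℕₚ.+-suc i s)) , ≡.trans J≡ (≡.sym (ℕₚ.+-suc i s))

    DiagonalPrefix-tail : ∀ {t} I J {i} → DiagonalPrefix (suc t) I J i →
      DiagonalPrefix t (I ∘ suc) (J ∘ suc) (suc i)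
    DiagonalPrefix-tail I J pre s s<t = OnDiagonal-tail I J (pre (suc s) (s≤s s<t))

    RunEnds-tail : ∀ {t k} I J {i} → RunEnds (suc t) k I J i → RunEnds t k (I ∘ suc) (J ∘ suc) (suc i)
    RunEnds-tail I J ends k≡1+k' on = ends k≡1+k' (OnDiagonal-untail I J on)

    DiagonalPrefix-start : ∀ {t I J i} → DiagonalPrefix (suc t) I J i → I 0 ≡ i × J 0 ≡ i
    DiagonalPrefix-start {i = i} pre =
      ≡.trans (proj₁ (pre 0 (s≤s z≤n))) (ℕₚ.+-identityʳ i) ,
      ≡.trans (proj₂ (pre 0 (s≤s z≤n))) (ℕₚ.+-identityʳ i)

  minor-diagonalRun : ∀ t k I J i → DiagonalPrefix t I J i →
    Increasing (t ℕ.+ k) I → Increasing (t ℕ.+ k) J → RunEnds t k I J i →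
    minorℕ (t ℕ.+ k) I J ≋ (continuant d β i t *ₚ minorℕ k (λ n → I (t ℕ.+ n)) (λ n → J (t ℕ.+ n)))
  minor-diagonalRun zero k I J i pre I-inc J-inc ends = ≋-sym (P.*-identityˡ _)
  minor-diagonalRun (suc zero) k I J i pre I-inc J-inc ends =
    minor-diagStart k I J i I0≡i J0≡i I-inc J-inc ends
    where
    I0≡i = proj₁ (DiagonalPrefix-start pre)
    J0≡i = proj₂ (DiagonalPrefix-start pre)
  minor-diagonalRun (suc (suc t)) k I J i pre I-inc J-inc ends = begin
    minorℕ (2 ℕ.+ t ℕ.+ k) I J
      ≈⟨ minor-diagPair (t ℕ.+ k) I J i I0≡i J0≡i (pre 1 (s≤s (s≤s z≤n))) I-inc J-inc ⟩
    (d i *ₚ minorℕ (suc t ℕ.+ k) I₁ J₁) -ₚ (u i *ₚ (l i *ₚ minorℕ (t ℕ.+ k) I₂ J₂))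
      ≈⟨ +ₚ-cong (*ₚ-cong (≋-refl {d i})
                   (minor-diagonalRun (suc t) k I₁ J₁ (suc i) (DiagonalPrefix-tail I J pre)
                      (Increasing-tail I-inc) (Increasing-tail J-inc) (RunEnds-tail I J ends)))
                 (-ₚ-cong (*ₚ-cong (≋-refl {u i}) (*ₚ-cong (≋-refl {l i})
                   (minor-diagonalRun t k I₂ J₂ (suc (suc i))
                      (DiagonalPrefix-tail I₁ J₁ (DiagonalPrefix-tail I J pre))
                      (Increasing-tail (Increasing-tail I-inc)) (Increasing-tail (Increasing-tail J-inc))
                      (RunEnds-tail I₁ J₁ (RunEnds-tail I J ends)))))) ⟩
    (d i *ₚ (C₁ *ₚ R)) -ₚ (u i *ₚ (l i *ₚ (C₂ *ₚ R)))
      ≈⟨ solve 6 (λ d C₁ u l C₂ R → d :* (C₁ :* R) :- u :* (l :* (C₂ :* R))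
                                   := (d :* C₁ :- (u :* l) :* C₂) :* R)
               ≋-refl (d i) C₁ (u i) (l i) C₂ R ⟩
    continuant d β i (2 ℕ.+ t) *ₚ R ∎
    where
    I₁ J₁ I₂ J₂ : ℕ → ℕ
    I₁ = I ∘ suc
    J₁ = J ∘ suc
    I₂ = λ n → I (suc (suc n))
    J₂ = λ n → J (suc (suc n))
    I0≡i = proj₁ (DiagonalPrefix-start pre)
    J0≡i = proj₂ (DiagonalPrefix-start pre)
    C₁ C₂ R : Polynomial
    C₁ = continuant d β (suc i) (suc t)
    C₂ = continuant d β (suc (suc i)) t
    R  = minorℕ k (λ n → I (2 ℕ.+ t ℕ.+ n)) (λ n → J (2 ℕ.+ t ℕ.+ n))

  data DiagonalRun (I J : ℕ → ℕ) (i : ℕ) : ℕ → Set where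
    diagonalRun : ∀ t k → 1 ℕ.≤ t → DiagonalPrefix t I J i → RunEnds t k I J i →
      DiagonalRun I J i (t ℕ.+ k)

  maximalDiagonalRun : ∀ t k I J i → 1 ℕ.≤ t → DiagonalPrefix t I J i → DiagonalRun I J i (t ℕ.+ k)
  maximalDiagonalRun t zero    I J i t≥1 pre = diagonalRun t zero t≥1 pre (λ ())
  maximalDiagonalRun t (suc k) I J i t≥1 pre with OnDiagonal? i I J t
  ... | no  off = diagonalRun t (suc k) t≥1 pre (λ _ → off)
  ... | yes on  = ≡.subst (DiagonalRun I J i) (≡.sym (ℕₚ.+-suc t k))
                    (maximalDiagonalRun (suc t) k I J i (s≤s z≤n) extended)
    where
    extended : DiagonalPrefix (suc t) I J i
    extended s s<1+t with ℕₚ.m<1+n⇒m<n∨m≡n s<1+t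
    ... | inj₁ s<t    = pre s s<t
    ... | inj₂ ≡.refl = on

  continuant≋minor : ∀ i n → continuant d β i n ≋ minorℕ n (i ℕ.+_) (i ℕ.+_)
  continuant≋minor i n =
    ≡.subst (λ m → continuant d β i n ≋ minorℕ m (i ℕ.+_) (i ℕ.+_)) (ℕₚ.+-identityʳ n)
      (≋-trans (≋-sym (P.*-identityʳ (continuant d β i n)))
        (≋-sym (minor-diagonalRun n 0 (i ℕ.+_) (i ℕ.+_) i (λ _ _ → ≡.refl , ≡.refl)
                  interval-increasing interval-increasing (λ ()))))
    where
    interval-increasing : Increasing (n ℕ.+ 0) (i ℕ.+_)
    interval-increasing m _ = ℕₚ.+-monoʳ-< i (ℕₚ.n<1+n m)

  TP⇒continuant-nonneg : ∀ r → TP r T → ∀ i n → n ℕ.≤ r → NonnegCoeffs (continuant d β i n)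
  TP⇒continuant-nonneg r tp i n n≤r = nonneg-resp (continuant≋minor i n)
    (tp n n≤r _ _ interval-increasing interval-increasing)
    where
    interval-increasing : StrictlyIncreasing {n} (λ s → i ℕ.+ toℕ s)
    interval-increasing s s' s<s' = ℕₚ.+-monoʳ-< i s<s'

  module _ (r : ℕ) (u≥0 : ∀ n → NonnegCoeffs (u n)) (l≥0 : ∀ n → NonnegCoeffs (l n))
           (continuant≥0 : ∀ i n → n ℕ.≤ r → NonnegCoeffs (continuant d β i n)) where

    MinorsNonneg : ℕ → Set ℓ₂
    MinorsNonneg n = n ℕ.≤ r → ∀ I J → Increasing n I → Increasing n J → NonnegCoeffs (minorℕ n I J)

    private
      diagonalMinor-nonneg : ∀ {n} I J i → DiagonalRun I J i n → (∀ {m} → m ℕ.< n → MinorsNonneg m) →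
        n ℕ.≤ r → Increasing n I → Increasing n J → NonnegCoeffs (minorℕ n I J)
      diagonalMinor-nonneg I J i (diagonalRun t k t≥1 pre ends) ih n≤r I-inc J-inc =
        nonneg-resp (minor-diagonalRun t k I J i pre I-inc J-inc ends)
          (nonneg-*ₚ {continuant d β i t} (continuant≥0 i t (ℕₚ.m+n≤o⇒m≤o t n≤r))
            (ih (ℕₚ.m<n+m k t≥1) (ℕₚ.m+n≤o⇒n≤o t n≤r) _ _
                (Increasing-drop t I-inc) (Increasing-drop t J-inc)))

    minorℕ-nonneg : ∀ n → MinorsNonneg n
    minorℕ-nonneg = <-rec MinorsNonneg step
      where
      step : ∀ n → (∀ {m} → m ℕ.< n → MinorsNonneg m) → MinorsNonneg n
      step zero    ih n≤r I J I-inc J-inc = nonneg-1ₚ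
      step (suc k) ih n≤r I J I-inc J-inc with ℕₚ.<-cmp (I 0) (J 0)
      ... | tri≈ _ I0≡J0 _ = diagonalMinor-nonneg I J (I 0)
              (maximalDiagonalRun 1 k I J (I 0) ℕₚ.≤-refl firstOnDiagonal) ih n≤r I-inc J-inc
        where
        firstOnDiagonal : DiagonalPrefix 1 I J (I 0)
        firstOnDiagonal zero    _         = ≡.sym (ℕₚ.+-identityʳ _) , ≡.trans (≡.sym I0≡J0) (≡.sym (ℕₚ.+-identityʳ _))
        firstOnDiagonal (suc s) (s≤s ())
      ... | tri< I0<J0 _ _ with J 0 ℕ.≟ suc (I 0)
      ...   | yes J0≡1+I0 = nonneg-resp (minor-superStart k I J J0≡1+I0 J-inc)
                (nonneg-*ₚ {u (I 0)} (u≥0 (I 0)) (ih (ℕₚ.n<1+n k) (ℕₚ.<⇒≤ n≤r) _ _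
                  (Increasing-tail I-inc) (Increasing-tail J-inc)))
      ...   | no  J0≢1+I0 = nonneg-resp
                (minor-aboveDiagonal k I J (ℕₚ.≤∧≢⇒< I0<J0 (J0≢1+I0 ∘ ≡.sym)) J-inc) nonneg-0ₚ
      step (suc k) ih n≤r I J I-inc J-inc | tri> _ _ J0<I0 with I 0 ℕ.≟ suc (J 0)
      ...   | yes I0≡1+J0 = nonneg-resp (minor-subStart k I J I0≡1+J0 I-inc)
                (nonneg-*ₚ {l (J 0)} (l≥0 (J 0)) (ih (ℕₚ.n<1+n k) (ℕₚ.<⇒≤ n≤r) _ _
                  (Increasing-tail I-inc) (Increasing-tail J-inc)))
      ...   | no  I0≢1+J0 = nonneg-resp
                (minor-belowDiagonal k I J (ℕₚ.≤∧≢⇒< J0<I0 (I0≢1+J0 ∘ ≡.sym)) I-inc) nonneg-0ₚ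

    continuant-nonneg⇒TP : TP r T
    continuant-nonneg⇒TP k k≤r I J I↑ J↑ =
      nonneg-resp (det-cong _ _ λ s s' → ≡⇒≋ (cong₂ T (≡.sym (extendIndex-toℕ I s)) (≡.sym (extendIndex-toℕ J s'))))
        (minorℕ-nonneg k k≤r (extendIndex I) (extendIndex J) (extendIndex-increasing I I↑) (extendIndex-increasing J J↑))
      where
      extendIndex : ∀ {k} → (Fin k → ℕ) → ℕ → ℕ
      extendIndex {k} I n with n ℕ.<? k
      ... | yes n<k = I (Fin.fromℕ< n<k)
      ... | no  _   = 0

      extendIndex-toℕ : ∀ {k} (I : Fin k → ℕ) s → extendIndex I (toℕ s) ≡ I s
      extendIndex-toℕ {k} I s with toℕ s ℕ.<? k
      ... | yes s<k = cong I (Finₚ.fromℕ<-toℕ s s<k)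
      ... | no  s≮k = ⊥-elim (s≮k (Finₚ.toℕ<n s))

      extendIndex-increasing : ∀ {k} (I : Fin k → ℕ) → StrictlyIncreasing I → Increasing k (extendIndex I)
      extendIndex-increasing {k} I I↑ n 1+n<k with n ℕ.<? k | suc n ℕ.<? k
      ... | yes n<k | yes 1+n<k′ = I↑ (Fin.fromℕ< n<k) (Fin.fromℕ< 1+n<k′)
              (≡.subst₂ ℕ._<_ (≡.sym (Finₚ.toℕ-fromℕ< n<k)) (≡.sym (Finₚ.toℕ-fromℕ< 1+n<k′)) (ℕₚ.n<1+n n))
      ... | no  n≮k | _          = ⊥-elim (n≮k (ℕₚ.<-trans (ℕₚ.n<1+n n) 1+n<k))
      ... | yes _   | no  1+n≮k  = ⊥-elim (1+n≮k 1+n<k)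

module ContinuantPerturbation {c ℓ₁ ℓ₂} (O : OrderedCommRing c ℓ₁ ℓ₂)
  (a a' β β' : ℕ → Poly.Polynomial O) where
  open Poly O
  open PolynomialRing O
  open Continuant O
  open IntegerCoefficientSolver polyRing using (solve; _:=_; _:+_; _:*_; _:-_; con)
  private module P = CommutativeRing polyRing
  open import Relation.Binary.Reasoning.Setoid P.setoid

  D D' : ℕ → ℕ → Polynomial
  D  = continuant a β
  D' = continuant (λ i → a i +ₚ a' i) β'

  γ : ℕ → Polynomial
  γ i = β i -ₚ β' i

  sumBelow : ℕ → (ℕ → Polynomial) → Polynomial
  sumBelow zero    f = 0ₚ
  sumBelow (suc n) f = f 0 +ₚ sumBelow n (f ∘ suc)

  sumBelow-cong : ∀ n {f g} → (∀ k → f k ≋ g k) → sumBelow n f ≋ sumBelow n g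
  sumBelow-cong zero    f≋g = ≋-refl
  sumBelow-cong (suc n) f≋g = +ₚ-cong (f≋g 0) (sumBelow-cong n (f≋g ∘ suc))

  sumBelow-linear : ∀ n x y f g →
    sumBelow n (λ k → (x *ₚ f k) -ₚ (y *ₚ g k)) ≋ ((x *ₚ sumBelow n f) -ₚ (y *ₚ sumBelow n g))
  sumBelow-linear zero    x y f g =
    solve 2 (λ x y → con (+ 0) := x :* con (+ 0) :- y :* con (+ 0)) ≋-refl x y
  sumBelow-linear (suc n) x y f g =
    ≋-trans (+ₚ-cong (≋-refl {(x *ₚ f 0) -ₚ (y *ₚ g 0)}) (sumBelow-linear n x y (f ∘ suc) (g ∘ suc)))
      (solve 6 (λ x y f₀ g₀ F G → (x :* f₀ :- y :* g₀) :+ (x :* F :- y :* G)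
                                  := x :* (f₀ :+ F) :- y :* (g₀ :+ G))
         ≋-refl x y (f 0) (g 0) (sumBelow n (f ∘ suc)) (sumBelow n (g ∘ suc)))

  sumBelow-nonneg : ∀ n f → (∀ k → k ℕ.< n → NonnegCoeffs (f k)) → NonnegCoeffs (sumBelow n f)
  sumBelow-nonneg zero    f f≥0 = nonneg-0ₚ
  sumBelow-nonneg (suc n) f f≥0 = nonneg-+ₚ {f 0} (f≥0 0 (s≤s z≤n))
    (sumBelow-nonneg n (f ∘ suc) (λ k k<n → f≥0 (suc k) (s≤s k<n)))

  -- D' - D obeys the recurrence of D with this inhomogeneous term, so it is the
  -- superposition `correction` of the solutions D started at every later index.
  source : ℕ → ℕ → Polynomial
  source i zero          = 0ₚ
  source i (suc zero)    = a' i
  source i (suc (suc m)) = (a' i *ₚ D' (suc i) (suc m)) +ₚ (γ i *ₚ D' (suc (suc i)) m)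

  correction : ℕ → ℕ → Polynomial
  correction i n = sumBelow n (λ k → D i k *ₚ source (i ℕ.+ k) (n ∸ k))

  correction-step : ∀ i n → correction i (2 ℕ.+ n) ≋
    (source i (2 ℕ.+ n) +ₚ ((a i *ₚ correction (suc i) (suc n)) -ₚ (β i *ₚ correction (2 ℕ.+ i) n)))
  correction-step i n = begin
    correction i (2 ℕ.+ n)
      ≈⟨ +ₚ-cong (*ₚ-cong (≋-refl {1ₚ}) (≡⇒≋ (cong (λ x → source x (2 ℕ.+ n)) (ℕₚ.+-identityʳ i))))
           (+ₚ-cong (*ₚ-cong (≋-refl {a i}) (≡⇒≋ (cong (λ x → source x (suc n)) i+1≡1+i+0)))
             (sumBelow-cong n unfoldD)) ⟩
    (1ₚ *ₚ S₀) +ₚ ((a i *ₚ S₁) +ₚ sumBelow n (λ k → (a i *ₚ f k) -ₚ (β i *ₚ g k)))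
      ≈⟨ +ₚ-cong (≋-refl {1ₚ *ₚ S₀}) (+ₚ-cong (≋-refl {a i *ₚ S₁}) (sumBelow-linear n (a i) (β i) f g)) ⟩
    (1ₚ *ₚ S₀) +ₚ ((a i *ₚ S₁) +ₚ ((a i *ₚ sumBelow n f) -ₚ (β i *ₚ sumBelow n g)))
      ≈⟨ solve 6 (λ S₀ a S₁ F b G → (con (+ 1) :* S₀) :+ ((a :* S₁) :+ ((a :* F) :- (b :* G)))
                                    := S₀ :+ ((a :* ((con (+ 1) :* S₁) :+ F)) :- (b :* G)))
               ≋-refl S₀ (a i) S₁ (sumBelow n f) (β i) (sumBelow n g) ⟩
    source i (2 ℕ.+ n) +ₚ ((a i *ₚ correction (suc i) (suc n)) -ₚ (β i *ₚ correction (2 ℕ.+ i) n)) ∎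
    where
    S₀ S₁ : Polynomial
    S₀ = source i (2 ℕ.+ n)
    S₁ = source (suc i ℕ.+ 0) (suc n)
    i+1≡1+i+0 : i ℕ.+ 1 ≡ suc i ℕ.+ 0
    i+1≡1+i+0 = ≡.trans (ℕₚ.+-comm i 1) (cong suc (≡.sym (ℕₚ.+-identityʳ i)))
    f g : ℕ → Polynomial
    f k = D (suc i) (suc k) *ₚ source (suc i ℕ.+ suc k) (n ∸ k)
    g k = D (2 ℕ.+ i) k *ₚ source (2 ℕ.+ i ℕ.+ k) (n ∸ k)
    unfoldD : ∀ k → (D i (2 ℕ.+ k) *ₚ source (i ℕ.+ (2 ℕ.+ k)) (n ∸ k)) ≋ ((a i *ₚ f k) -ₚ (β i *ₚ g k))
    unfoldD k =
      ≋-trans (*ₚ-cong (≋-refl {D i (2 ℕ.+ k)}) (≡⇒≋ (cong (λ x → source x (n ∸ k)) (ℕₚ.+-suc i (suc k)))))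
        (≋-trans (solve 5 (λ x X y Y S → (x :* X :- y :* Y) :* S := x :* (X :* S) :- y :* (Y :* S)) ≋-refl
                    (a i) (D (suc i) (suc k)) (β i) (D (2 ℕ.+ i) k) (source (suc i ℕ.+ suc k) (n ∸ k)))
          (+ₚ-cong (≋-refl {a i *ₚ f k}) (-ₚ-cong (*ₚ-cong (≋-refl {β i}) (*ₚ-cong (≋-refl {D (2 ℕ.+ i) k})
            (≡⇒≋ (cong (λ x → source (suc x) (n ∸ k)) (ℕₚ.+-suc i k))))))))

  continuant-perturbation : ∀ n i → D' i n ≋ (D i n +ₚ correction i n)
  continuant-perturbation zero          i = ≋-sym (+ₚ-identityʳ 1ₚ)
  continuant-perturbation (suc zero)    i = +ₚ-cong (≋-refl {a i})
    (≋-sym (≋-trans (+ₚ-identityʳ _) (≋-trans (P.*-identityˡ _) (≡⇒≋ (cong a' (ℕₚ.+-identityʳ i))))))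
  continuant-perturbation (suc (suc n)) i = begin
    ((a i +ₚ a' i) *ₚ D' (suc i) (suc n)) -ₚ (β' i *ₚ D' (2 ℕ.+ i) n)
      ≈⟨ +ₚ-cong (*ₚ-cong (≋-refl {a i +ₚ a' i}) (continuant-perturbation (suc n) (suc i)))
           (-ₚ-cong (*ₚ-cong (≋-refl {β' i}) (continuant-perturbation n (2 ℕ.+ i)))) ⟩
    ((a i +ₚ a' i) *ₚ (D₁ +ₚ E₁)) -ₚ (β' i *ₚ (D₂ +ₚ E₂))
      ≈⟨ solve 8 (λ a a' b b' D₁ E₁ D₂ E₂ → (a :+ a') :* (D₁ :+ E₁) :- b' :* (D₂ :+ E₂)
                   := (a :* D₁ :- b :* D₂) :+ (((a' :* (D₁ :+ E₁)) :+ ((b :- b') :* (D₂ :+ E₂)))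
                                                :+ (a :* E₁ :- b :* E₂)))
           ≋-refl (a i) (a' i) (β i) (β' i) D₁ E₁ D₂ E₂ ⟩
    D i (2 ℕ.+ n) +ₚ (((a' i *ₚ (D₁ +ₚ E₁)) +ₚ (γ i *ₚ (D₂ +ₚ E₂))) +ₚ ((a i *ₚ E₁) -ₚ (β i *ₚ E₂)))
      ≈⟨ +ₚ-cong (≋-refl {D i (2 ℕ.+ n)})
           (+ₚ-cong (+ₚ-cong (*ₚ-cong (≋-refl {a' i}) (≋-sym (continuant-perturbation (suc n) (suc i))))
                             (*ₚ-cong (≋-refl {γ i}) (≋-sym (continuant-perturbation n (2 ℕ.+ i)))))
                    (≋-refl {(a i *ₚ E₁) -ₚ (β i *ₚ E₂)})) ⟩
    D i (2 ℕ.+ n) +ₚ (source i (2 ℕ.+ n) +ₚ ((a i *ₚ E₁) -ₚ (β i *ₚ E₂)))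
      ≈⟨ +ₚ-cong (≋-refl {D i (2 ℕ.+ n)}) (≋-sym (correction-step i n)) ⟩
    D i (2 ℕ.+ n) +ₚ correction i (2 ℕ.+ n) ∎
    where
    D₁ E₁ D₂ E₂ : Polynomial
    D₁ = D (suc i) (suc n)
    E₁ = correction (suc i) (suc n)
    D₂ = D (2 ℕ.+ i) n
    E₂ = correction (2 ℕ.+ i) n

  module _ (r : ℕ) (a'≥0 : ∀ i → NonnegCoeffs (a' i)) (γ≥0 : ∀ i → NonnegCoeffs (γ i))
           (D≥0 : ∀ i n → n ℕ.≤ r → NonnegCoeffs (D i n)) where

    PerturbedNonneg : ℕ → Set ℓ₂
    PerturbedNonneg n = n ℕ.≤ r → ∀ i → NonnegCoeffs (D' i n)

    private
      source-nonneg : ∀ m j → (∀ {m'} → m' ℕ.< m → ∀ j → NonnegCoeffs (D' j m')) →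
        NonnegCoeffs (source j m)
      source-nonneg zero          j _   = nonneg-0ₚ
      source-nonneg (suc zero)    j _   = a'≥0 j
      source-nonneg (suc (suc m)) j D'≥0 =
        nonneg-+ₚ {a' j *ₚ D' (suc j) (suc m)}
          (nonneg-*ₚ {a' j} (a'≥0 j) (D'≥0 (ℕₚ.n<1+n (suc m)) (suc j)))
          (nonneg-*ₚ {γ j} (γ≥0 j) (D'≥0 (ℕₚ.<-trans (ℕₚ.n<1+n m) (ℕₚ.n<1+n (suc m))) (2 ℕ.+ j)))

    perturbed-continuant-nonneg : ∀ n → PerturbedNonneg n
    perturbed-continuant-nonneg = <-rec PerturbedNonneg λ n ih n≤r i →
      nonneg-resp (continuant-perturbation n i) (nonneg-+ₚ {D i n} (D≥0 i n n≤r)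
        (sumBelow-nonneg n _ λ k k<n →
          nonneg-*ₚ {D i k} (D≥0 i k (ℕₚ.≤-trans (ℕₚ.<⇒≤ k<n) n≤r))
            (source-nonneg (n ∸ k) (i ℕ.+ k) λ m'<n∸k →
              ih (ℕₚ.<-≤-trans m'<n∸k (ℕₚ.m∸n≤m n k))
                 (ℕₚ.≤-trans (ℕₚ.<⇒≤ (ℕₚ.<-≤-trans m'<n∸k (ℕₚ.m∸n≤m n k))) n≤r))))

module ProductPerturbation {c ℓ₁ ℓ₂} (O : OrderedCommRing c ℓ₁ ℓ₂) where
  open Poly O
  open PolynomialRing O
  open IntegerCoefficientSolver polyRing using (solve; _:=_; _:+_; _:*_; _:-_)

  xy-[x-x'][y-y']-nonneg : ∀ x x' y y' → NonnegCoeffs x → NonnegCoeffs x' →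
    NonnegCoeffs y' → NonnegCoeffs (y -ₚ y') → NonnegCoeffs ((x *ₚ y) -ₚ ((x -ₚ x') *ₚ (y -ₚ y')))
  xy-[x-x'][y-y']-nonneg x x' y y' x≥0 x'≥0 y'≥0 y-y'≥0 =
    nonneg-resp (solve 4 (λ x x' y y' → x :* y :- (x :- x') :* (y :- y') := x :* y' :+ x' :* (y :- y'))
                   ≋-refl x x' y y')
      (nonneg-+ₚ {x *ₚ y'} (nonneg-*ₚ {x} x≥0 y'≥0) (nonneg-*ₚ {x'} x'≥0 y-y'≥0))

proposition3p1 : ∀ {c ℓ₁ ℓ₂} (O : OrderedCommRing c ℓ₁ ℓ₂) → let open Poly O in
    (r : ℕ) (a b c a' b' c' : ℕ → Polynomial) →
    (∀ n → NonnegCoeffs (a n)) → (∀ n → NonnegCoeffs (b n)) → (∀ n → NonnegCoeffs (c n)) →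
    (∀ n → NonnegCoeffs (a' n)) → (∀ n → NonnegCoeffs (b' n)) → (∀ n → NonnegCoeffs (c' n)) →
    (∀ n → NonnegCoeffs (b n -ₚ b' n)) → (∀ n → NonnegCoeffs (c n -ₚ c' n)) →
    TP r (tridiag a b c) →
    TP r (tridiag (λ n → a n +ₚ a' n) (λ n → b n -ₚ b' n) (λ n → c n -ₚ c' n))
proposition3p1 O r a b c a' b' c' _ b≥0 _ a'≥0 b'≥0 c'≥0 b-b'≥0 c-c'≥0 tp =
  New.continuant-nonneg⇒TP r b-b'≥0 c-c'≥0 λ i n n≤r →
    Perturbation.perturbed-continuant-nonneg r a'≥0
      (λ i → xy-[x-x'][y-y']-nonneg (b i) (b' i) (c i) (c' i) (b≥0 i) (b'≥0 i) (c'≥0 i) (c-c'≥0 i))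
      (Old.TP⇒continuant-nonneg r tp) n n≤r i
  where
  open Poly O
  open ProductPerturbation O
  module Old = TridiagonalMinors O a b c
  module New = TridiagonalMinors O (λ n → a n +ₚ a' n) (λ n → b n -ₚ b' n) (λ n → c n -ₚ c' n)
  module Perturbation = ContinuantPerturbation O a a' Old.β New.β
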